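{- The set $\operatorname{Sort}(\operatorname{SC}_{12})$ is equal to the permutation class $\operatorname{Av}(213)$, while $\operatorname{Sort}(\operatorname{SC}_{21})$ is not a permutation class. If $\sigma\in S_k$ for some $k\geq 3$, then $\operatorname{Sort}(\operatorname{SC}_\sigma)$ is a permutation class if and only if both $\sigma$ and $\widehat\sigma$ contain the pattern $231$ classically; in this case $\operatorname{Sort}(\operatorname{SC}_\sigma)=\operatorname{Av}(132)$.
   Context: $S_n$ is the set of permutations of $[n]=\{1,\dots,n\}$, written in one-line notation. Two sequences of distinct integers have the same relative order if replacing the $i$th smallest entry of each by $i$ yields the same word. A permutation $\tau$ contains $\sigma$ classically if some (not necessarily consecutive) subsequence of $\tau$ has the same relative order as $\sigma$, and contains $\sigma$ consecutively if some consecutive subsequence does; otherwise $\tau$ avoids $\sigma$ classically/consecutively. $\operatorname{Av}(\tau^{(1)},\dots)$ denotes the set of all permutations (of all lengths $n\ge 0$) avoiding the listed patterns classically. For a set $\mathcal A$ of permutations, the map $T_{\mathcal A}:S_n\to S_n$ is defined as follows: send $\pi=\pi_1\cdots\pi_n$ through a stack; at each step, if there is a next input entry and placing it on top of the stack would make the stack contents, read from top to bottom, have the same relative order as some element of $\mathcal A$, push it; otherwise pop the top entry of the stack and append it to the end of the output. Stop when the output has length $n$; $T_{\mathcal A}(\pi)$ is the output. For a permutation $\sigma$, $\operatorname{SC}_\sigma=T_{\mathcal A}$ where $\mathcal A$ is the set of permutations avoiding $\sigma$ consecutively. $\operatorname{Sort}(\operatorname{SC}_\sigma)=\operatorname{SC}_\sigma^{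 -1}(\operatorname{Av}(231))$ is the set of permutations $\pi$ (of any length) such that $\operatorname{SC}_\sigma(\pi)$ avoids $231$ classically. For $\sigma=\sigma_1\sigma_2\sigma_3\cdots\sigma_k$, $\widehat\sigma=\sigma_2\sigma_1\sigma_3\cdots\sigma_k$. A permutation class is a set of permutations closed under classical pattern containment (if $\sigma$ is in the set and $\sigma$ contains $\tau$ classically then $\tau$ is in the set). -}

module Defs where

open import Data.Nat using (ℕ; suc; _<_)
open import Data.List using (List; []; _∷_; _++_; length; map; upTo)
open import Data.List.Relation.Binary.Permutation.Propositional using (_↭_)
open import Data.List.Relation.Binary.Sublist.Propositional using (_⊆_)
open import Data.List.Relation.Binary.Pointwise using (Pointwise)
open import Data.Product using (Σ; _×_; ∃; ∃-syntax)
open import Data.Unit using (⊤)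
open import Relation.Nullary using (¬_)
open import Relation.Binary.PropositionalEquality using (_≡_)
open import Function.Bundles using (_⇔_)

-- A permutation of [n] in one-line notation: a list that is a rearrangement of 1,…,n
-- where n is its length.
IsPerm : List ℕ → Set
IsPerm xs = xs ↭ map suc (upTo (length xs))

-- Same relative order (for sequences of distinct entries): equal length, and for
-- every pair of positions i < j, x_i < x_j iff y_i < y_j.
data SameOrder : List ℕ → List ℕ → Set where
  []  : SameOrder [] []
  _∷_ : ∀ {x y xs ys} →
        Pointwise (λ a b → (x < a) ⇔ (y < b)) xs ys →
        SameOrder xs ys → SameOrder (x ∷ xs) (y ∷ ys)

Contains : List ℕ → List ℕ → Set
Contains τ σ = ∃[ s ] (s ⊆ τ × SameOrder s σ)

ContainsConsec : List ℕ → List ℕ → Set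
ContainsConsec τ σ = ∃[ s ] ∃[ pre ] ∃[ suf ] (τ ≡ pre ++ s ++ suf) × SameOrder s σ

Av : List ℕ → List ℕ → Set
Av τ π = IsPerm π × ¬ Contains π τ

PermSet : Set₁
PermSet = List ℕ → Set

IsPermClass : PermSet → Set
IsPermClass C = ∀ π τ → C π → IsPerm τ → Contains π τ → C τ

_≐_ : PermSet → PermSet → Set
C ≐ D = ∀ π → C π ⇔ D π

-- Condition for pushing: the proposed stack (top to bottom) has the same
-- relative order as some element of 𝒜.
CanPush : PermSet → List ℕ → Set
CanPush 𝒜 st = ∃[ α ] (𝒜 α × SameOrder st α)

-- "we do not push": either there is no next input entry, or pushing it is not allowed
NoPush : PermSet → List ℕ → List ℕ → Set
NoPush 𝒜 []      st = ⊤
NoPush 𝒜 (x ∷ _) st = ¬ CanPush 𝒜 (x ∷ st)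

-- Run 𝒜 input stack out : starting from the given remaining input and stack
-- (listed top to bottom), the stack algorithm T_𝒜 appends exactly `out` to the
-- output before stopping (stopping happens when input and stack are empty,
-- i.e. when the output has length n).
data Run (𝒜 : PermSet) : List ℕ → List ℕ → List ℕ → Set where
  stop : Run 𝒜 [] [] []
  push : ∀ {x xs st out} → CanPush 𝒜 (x ∷ st) →
         Run 𝒜 xs (x ∷ st) out → Run 𝒜 (x ∷ xs) st out
  pop  : ∀ {inp y st out} → NoPush 𝒜 inp (y ∷ st) →
         Run 𝒜 inp st out → Run 𝒜 inp (y ∷ st) (y ∷ out)

T : PermSet → List ℕ → List ℕ → Set
T 𝒜 π out = Run 𝒜 π [] out

-- 𝒜 for SC_σ: permutations avoiding σ consecutively
AvConsec : List ℕ → PermSet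
AvConsec σ α = IsPerm α × ¬ ContainsConsec α σ

SC : List ℕ → List ℕ → List ℕ → Set
SC σ = T (AvConsec σ)

Sort : List ℕ → PermSet
Sort σ π = IsPerm π × ∃[ out ] (SC σ π out × Av (2 ∷ 3 ∷ 1 ∷ []) out)

hat : List ℕ → List ℕ
hat (a ∷ b ∷ r) = b ∷ a ∷ r
hat xs          = xs

module Submission where

-- SC_σ pushes as long as the stack avoids σ consecutively.  For σ = 12 the stack stays
-- decreasing, and splitting π = L m R at its minimum m gives SC(π) = SC(L) SC(R) m; by
-- induction SC(π) contains 231 iff π contains 213.  If σ and σ̂ both contain 231, any pop
-- forced while input remains puts the popped entry z in front of the refused entry x and the
-- stack below, which contain σ or (as z x …) σ̂, hence 231; so π is sorted iff SC(π) = reverse π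
-- avoids 231, i.e. iff π avoids 132.  In every other case a sorted π containing an unsorted τ
-- shows that Sort(SC_σ) is not a class: for σ = 21 and |σ| = 3 the pair is checked by
-- computation, for |σ| ≥ 4 it is built from σ, according to which of σ, σ̂ contain 231
-- and to the relative order of σ₁, σ₂ and the rest of σ.

open import Defs

open import Data.Empty using (⊥-elim)
open import Data.Unit using (tt)
open import Data.Product using (_×_; _,_; proj₁; proj₂; ∃-syntax)
open import Data.Sum using (_⊎_; inj₁; inj₂; [_,_]′)
open import Data.Sum.Function.Propositional using (_⊎-⇔_)
open import Data.Nat using (ℕ; zero; suc; _+_; _∸_; _≤_; _<_; z≤n; s≤s; _<?_; _≟_)
open import Data.Nat.Properties
open import Data.List using (List; []; _∷_; _++_; [_]; length; map; upTo; applyUpTo; reverse; take; drop; iterate)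
open import Data.List.Properties
  using (++-assoc; ++-identityʳ; length-++; length-map; map-++; map-∘; map-id; take++drop≡id; take-all;
         unfold-reverse; reverse-involutive; reverse-map; reverse-++; ∷ʳ-++; map-applyUpTo; length-iterate)
open import Data.List.Extrema.Nat using (min; min≤⊤; min≤xs; argmin-sel)
open import Data.List.Membership.Propositional using (_∈_; find)
open import Data.List.Membership.Propositional.Properties using (∈-∃++)
open import Data.List.Relation.Unary.All as All using (All; []; _∷_)
open import Data.List.Relation.Unary.All.Properties using (++⁻ˡ; ++⁻ʳ; ¬Any⇒All¬)
  renaming (++⁺ to All-++⁺; map⁺ to All-map⁺)
open import Data.List.Relation.Unary.Any using (Any; here; there; any?)
open import Data.List.Relation.Unary.AllPairs using ([]; _∷_)
open import Data.List.Relation.Unary.Linked using (Linked; []; [-]; _∷_)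
open import Data.List.Relation.Unary.Unique.Propositional using (Unique)
open import Data.List.Relation.Unary.Unique.Propositional.Properties using () renaming (map⁺ to Unique-map⁺)
open import Data.List.Relation.Unary.Unique.DecPropositional _≟_ using (unique?)
import Data.List.Relation.Binary.Pointwise as Pointwise
open import Data.List.Relation.Binary.Pointwise using (Pointwise; []; _∷_)
open import Data.List.Relation.Binary.Sublist.Propositional
  using (_⊆_; []; _∷_; _∷ʳ_; ⊆-refl; ⊆-trans; minimum; from∈; to∈)
open import Data.List.Relation.Binary.Sublist.Propositional.Properties
  using (All-resp-⊆; length-mono-≤; ++⁺ˡ; ++⁺ʳ; reverse⁺; take-⊆)
  renaming (++⁺ to ⊆-++⁺)
open import Data.List.Relation.Binary.Permutation.Propositional
  using (_↭_; ↭-refl; ↭-sym; ↭-trans; prep; swap; ↭⇒↭ₛ; module PermutationReasoning)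
open import Data.List.Relation.Binary.Permutation.Propositional.Properties
  using (map⁺; shift; ↭-length; All-resp-↭; ↭-reverse; ∈-resp-↭; ∷↭∷ʳ; ++-comm)
  renaming (++⁺ˡ to ↭-++⁺ˡ; ++⁺ʳ to ↭-++⁺ʳ)
import Data.List.Relation.Binary.Permutation.Setoid.Properties as PermutationSetoid
open import Function.Base using (case_of_; _∘_)
open import Function.Bundles using (_⇔_; mk⇔; Equivalence)
open import Function.Construct.Identity using (⇔-id)
open import Function.Construct.Symmetry using (⇔-sym)
import Function.Properties.Equivalence as ⇔
open import Relation.Binary.Definitions using (tri<; tri≈; tri>)
open import Relation.Binary.PropositionalEquality
  using (_≡_; refl; sym; trans; cong; cong₂; subst; subst₂; setoid; module ≡-Reasoning)
open import Relation.Nullary using (¬_; Dec; yes; no)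
open import Relation.Nullary.Decidable
  using (from-yes; True; False; toWitness; toWitnessFalse; _×-dec_; _→-dec_; _⊎-dec_)
import Relation.Nullary.Decidable as Dec

open Equivalence using (to; from)

-- Relative order and classical containment

SameOrder-refl : ∀ l → SameOrder l l
SameOrder-refl []      = []
SameOrder-refl (x ∷ l) = Pointwise.refl (⇔-id _) ∷ SameOrder-refl l

SameOrder-sym : ∀ {l m} → SameOrder l m → SameOrder m l
SameOrder-sym []       = []
SameOrder-sym (p ∷ so) = Pointwise.symmetric ⇔-sym p ∷ SameOrder-sym so

SameOrder-trans : ∀ {l m n} → SameOrder l m → SameOrder m n → SameOrder l n
SameOrder-trans []       []       = []
SameOrder-trans (p ∷ so) (q ∷ so′) = Pointwise.transitive ⇔.trans p q ∷ SameOrder-trans so so′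

SameOrder-length : ∀ {l m} → SameOrder l m → length l ≡ length m
SameOrder-length []       = refl
SameOrder-length (_ ∷ so) = cong suc (SameOrder-length so)

-- The entries of m at the positions that s occupies in l.
select : ∀ {s l : List ℕ} → s ⊆ l → List ℕ → List ℕ
select []       _       = []
select (_ ∷ʳ p) []      = []
select (_ ∷ʳ p) (_ ∷ m) = select p m
select (_ ∷ p)  []      = []
select (_ ∷ p)  (z ∷ m) = z ∷ select p m

select-⊆ : ∀ {s l m} → length l ≡ length m → (p : s ⊆ l) → select p m ⊆ m
select-⊆ {m = []}    _ []         = []
select-⊆ {m = z ∷ m} e (_ ∷ʳ p)   = z ∷ʳ select-⊆ (suc-injective e) p
select-⊆ {m = z ∷ m} e (refl ∷ p) = refl ∷ select-⊆ (suc-injective e) p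

Pointwise-select : ∀ {R : ℕ → ℕ → Set} {s l m} → Pointwise R l m → (p : s ⊆ l) → Pointwise R s (select p m)
Pointwise-select []       []         = []
Pointwise-select (_ ∷ rs) (_ ∷ʳ p)   = Pointwise-select rs p
Pointwise-select (r ∷ rs) (refl ∷ p) = r ∷ Pointwise-select rs p

SameOrder-select : ∀ {s l m} → SameOrder l m → (p : s ⊆ l) → SameOrder s (select p m)
SameOrder-select []       []         = []
SameOrder-select (_ ∷ so) (_ ∷ʳ p)   = SameOrder-select so p
SameOrder-select (q ∷ so) (refl ∷ p) = Pointwise-select q p ∷ SameOrder-select so p

SameOrder-⊆ : ∀ {s l m} → SameOrder l m → s ⊆ l → ∃[ t ] (t ⊆ m × SameOrder s t)
SameOrder-⊆ so p = select p _ , select-⊆ (SameOrder-length so) p , SameOrder-select so p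

Contains-trans : ∀ {π τ ρ} → Contains π τ → Contains τ ρ → Contains π ρ
Contains-trans (s , s⊆π , s≅τ) (t , t⊆τ , t≅ρ) with SameOrder-⊆ (SameOrder-sym s≅τ) t⊆τ
... | t′ , t′⊆s , t≅t′ = t′ , ⊆-trans t′⊆s s⊆π , SameOrder-trans (SameOrder-sym t≅t′) t≅ρ

Contains-resp-⊆ : ∀ {π π′ τ} → π ⊆ π′ → Contains π τ → Contains π′ τ
Contains-resp-⊆ q (s , p , so) = s , ⊆-trans p q , so

Contains-resp-SameOrder : ∀ {π π′ τ} → SameOrder π π′ → Contains π τ → Contains π′ τ
Contains-resp-SameOrder {π′ = π′} so = Contains-trans (π′ , ⊆-refl , SameOrder-sym so)

Av-isPermClass : ∀ ρ → IsPermClass (Av ρ)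
Av-isPermClass ρ π τ (_ , π∌ρ) τ-perm π∋τ = τ-perm , λ τ∋ρ → π∌ρ (Contains-trans π∋τ τ∋ρ)

IsPermClass-resp-≐ : ∀ {C D : PermSet} → C ≐ D → IsPermClass D → IsPermClass C
IsPermClass-resp-≐ C≐D D-class π τ Cπ τ-perm π∋τ = from (C≐D τ) (D-class π τ (to (C≐D π) Cπ) τ-perm π∋τ)

⇔-both : ∀ {A B : Set} → A → B → A ⇔ B
⇔-both a b = mk⇔ (λ _ → b) (λ _ → a)

⇔-neither : ∀ {A B : Set} → ¬ A → ¬ B → A ⇔ B
⇔-neither ¬a ¬b = mk⇔ (λ a → ⊥-elim (¬a a)) (λ b → ⊥-elim (¬b b))

sameOrder₂ : ∀ {a b x y} → (a < b ⇔ x < y) → SameOrder (a ∷ b ∷ []) (x ∷ y ∷ [])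
sameOrder₂ e = (e ∷ []) ∷ ([] ∷ [])

sameOrder₃ : ∀ {a b c x y z} → (a < b ⇔ x < y) → (a < c ⇔ x < z) → (b < c ⇔ y < z) →
             SameOrder (a ∷ b ∷ c ∷ []) (x ∷ y ∷ z ∷ [])
sameOrder₃ e₁ e₂ e₃ = (e₁ ∷ e₂ ∷ []) ∷ (e₃ ∷ []) ∷ ([] ∷ [])

private
  1<2 : 1 < 2
  1<2 = s≤s (s≤s z≤n)
  1<3 : 1 < 3
  1<3 = s≤s (s≤s z≤n)
  2<3 : 2 < 3
  2<3 = s≤s (s≤s (s≤s z≤n))
  2≮1 : ¬ (2 < 1)
  2≮1 (s≤s ())
  3≮1 : ¬ (3 < 1)
  3≮1 (s≤s ())
  3≮2 : ¬ (3 < 2)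
  3≮2 (s≤s (s≤s ()))
  2≤3 : 2 ≤ 3
  2≤3 = s≤s (s≤s z≤n)

Has12 Has132 Has213 Has231 : List ℕ → Set
Has12  l = Contains l (1 ∷ 2 ∷ [])
Has132 l = Contains l (1 ∷ 3 ∷ 2 ∷ [])
Has213 l = Contains l (2 ∷ 1 ∷ 3 ∷ [])
Has231 l = Contains l (2 ∷ 3 ∷ 1 ∷ [])

has12 : ∀ {a b l} → (a ∷ b ∷ []) ⊆ l → a < b → Has12 l
has12 p a<b = _ , p , sameOrder₂ (⇔-both a<b 1<2)

has12⁻ : ∀ {l} → Has12 l → ∃[ a ] ∃[ b ] ((a ∷ b ∷ []) ⊆ l × a < b)
has12⁻ (a ∷ b ∷ [] , p , (e ∷ []) ∷ _) = a , b , p , from e 1<2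

has132 : ∀ {a b c l} → (a ∷ c ∷ b ∷ []) ⊆ l → a < b → b < c → Has132 l
has132 p a<b b<c =
  _ , p , sameOrder₃ (⇔-both (<-trans a<b b<c) 1<3) (⇔-both a<b 1<2) (⇔-neither (<-asym b<c) 3≮2)

has132⁻ : ∀ {l} → Has132 l → ∃[ a ] ∃[ c ] ∃[ b ] ((a ∷ c ∷ b ∷ []) ⊆ l × a < c × a < b × ¬ (c < b))
has132⁻ (a ∷ c ∷ b ∷ [] , p , (e₁ ∷ e₂ ∷ []) ∷ (e₃ ∷ []) ∷ _) =
  a , c , b , p , from e₁ 1<3 , from e₂ 1<2 , λ c<b → 3≮2 (to e₃ c<b)

has213 : ∀ {a b c l} → (b ∷ a ∷ c ∷ []) ⊆ l → a < b → b < c → Has213 l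
has213 p a<b b<c =
  _ , p , sameOrder₃ (⇔-neither (<-asym a<b) 2≮1) (⇔-both b<c 2<3) (⇔-both (<-trans a<b b<c) 1<3)

has231 : ∀ {a b c l} → (b ∷ c ∷ a ∷ []) ⊆ l → b < c → a < b → Has231 l
has231 p b<c a<b =
  _ , p , sameOrder₃ (⇔-both b<c 2<3) (⇔-neither (<-asym a<b) 2≮1) (⇔-neither (<-asym (<-trans a<b b<c)) 3≮1)

has231⁻ : ∀ {l} → Has231 l → ∃[ b ] ∃[ c ] ∃[ a ] ((b ∷ c ∷ a ∷ []) ⊆ l × b < c × ¬ (b < a) × ¬ (c < a))
has231⁻ (b ∷ c ∷ a ∷ [] , p , (e₁ ∷ e₂ ∷ []) ∷ (e₃ ∷ []) ∷ _) =
  b , c , a , p , from e₁ 2<3 , (λ b<a → 2≮1 (to e₂ b<a)) , (λ c<a → 3≮1 (to e₃ c<a))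

-- Consecutive containment

_⇔?_ : ∀ {A B : Set} → Dec A → Dec B → Dec (A ⇔ B)
a? ⇔? b? = Dec.map′ (λ (f , g) → mk⇔ f g) (λ e → to e , from e) ((a? →-dec b?) ×-dec (b? →-dec a?))

SameOrder? : ∀ l m → Dec (SameOrder l m)
SameOrder? []      []      = yes []
SameOrder? []      (_ ∷ _) = no λ ()
SameOrder? (_ ∷ _) []      = no λ ()
SameOrder? (x ∷ l) (y ∷ m) =
  Dec.map′ (λ (p , so) → p ∷ so) (λ { (p ∷ so) → p , so })
           (Pointwise.decidable (λ a b → (x <? a) ⇔? (y <? b)) l m ×-dec SameOrder? l m)

Pointwise-take : ∀ {R : ℕ → ℕ → Set} p {q m} → Pointwise R (p ++ q) m → Pointwise R p (take (length p) m)
Pointwise-take []      _        = []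
Pointwise-take (_ ∷ p) (r ∷ rs) = r ∷ Pointwise-take p rs

SameOrder-++⁻ˡ : ∀ p {q m} → SameOrder (p ++ q) m → SameOrder p (take (length p) m)
SameOrder-++⁻ˡ []      _        = []
SameOrder-++⁻ˡ (_ ∷ p) (r ∷ so) = Pointwise-take p r ∷ SameOrder-++⁻ˡ p so

SameOrder-++⁻ʳ : ∀ p {q m} → SameOrder (p ++ q) m → SameOrder q (drop (length p) m)
SameOrder-++⁻ʳ []      so       = so
SameOrder-++⁻ʳ (_ ∷ p) (_ ∷ so) = SameOrder-++⁻ʳ p so

take-length-++ : ∀ (s suf : List ℕ) → take (length s) (s ++ suf) ≡ s
take-length-++ []      _   = refl
take-length-++ (x ∷ s) suf = cong (x ∷_) (take-length-++ s suf)

OccursAtStart : List ℕ → List ℕ → Set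
OccursAtStart l σ = SameOrder (take (length σ) l) σ

OccursAtStart? : ∀ l σ → Dec (OccursAtStart l σ)
OccursAtStart? l σ = SameOrder? (take (length σ) l) σ

OccursAtStart⇒ContainsConsec : ∀ {l σ} → OccursAtStart l σ → ContainsConsec l σ
OccursAtStart⇒ContainsConsec {l} {σ} so = _ , [] , drop (length σ) l , sym (take++drop≡id (length σ) l) , so

ContainsConsec-∷⁺ : ∀ {x l σ} → ContainsConsec l σ → ContainsConsec (x ∷ l) σ
ContainsConsec-∷⁺ (s , pre , suf , refl , so) = s , _ ∷ pre , suf , refl , so

ContainsConsec-∷⁻ : ∀ {x l σ} → ContainsConsec (x ∷ l) σ → OccursAtStart (x ∷ l) σ ⊎ ContainsConsec l σ
ContainsConsec-∷⁻ {σ = σ} (s , [] , suf , e , so) =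
  inj₁ (subst (λ t → SameOrder (take (length σ) t) σ) (sym e)
              (subst (λ n → SameOrder (take n (s ++ suf)) σ) (SameOrder-length so)
                     (subst (λ t → SameOrder t σ) (sym (take-length-++ s suf)) so)))
ContainsConsec-∷⁻ (s , _ ∷ pre , suf , refl , so) = inj₂ (s , pre , suf , refl , so)

ContainsConsec-[]⁻ : ∀ {σ} → ContainsConsec [] σ → σ ≡ []
ContainsConsec-[]⁻ ([] , [] , [] , refl , []) = refl

ContainsConsec? : ∀ l σ → Dec (ContainsConsec l σ)
ContainsConsec? [] [] = yes ([] , [] , [] , refl , [])
ContainsConsec? [] (x ∷ σ) = no λ c → case ContainsConsec-[]⁻ c of λ ()
ContainsConsec? (x ∷ l) σ =
  Dec.map′ [ OccursAtStart⇒ContainsConsec , ContainsConsec-∷⁺ ]′ ContainsConsec-∷⁻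
           (OccursAtStart? (x ∷ l) σ ⊎-dec ContainsConsec? l σ)

ContainsConsec-resp-SameOrder : ∀ {l α σ} → ContainsConsec l σ → SameOrder l α → ContainsConsec α σ
ContainsConsec-resp-SameOrder {α = α} (s , pre , suf , refl , s≅σ) so =
  take (length s) rest , take (length pre) α , drop (length s) rest ,
  sym (trans (cong (take (length pre) α ++_) (take++drop≡id (length s) rest)) (take++drop≡id (length pre) α)) ,
  SameOrder-trans (SameOrder-sym (SameOrder-++⁻ˡ s (SameOrder-++⁻ʳ pre so))) s≅σ
  where rest = drop (length pre) α

infix-⊆ : ∀ {l pre s suf : List ℕ} → l ≡ pre ++ s ++ suf → s ⊆ l
infix-⊆ {pre = pre} {s} {suf} refl = ++⁺ˡ pre (++⁺ʳ suf (⊆-refl {x = s}))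

ContainsConsec⇒Contains : ∀ {l σ} → ContainsConsec l σ → Contains l σ
ContainsConsec⇒Contains (s , pre , suf , e , so) = s , infix-⊆ {pre = pre} {suf = suf} e , so

ContainsConsec-length : ∀ {l σ} → ContainsConsec l σ → length σ ≤ length l
ContainsConsec-length (s , pre , suf , e , so) =
  subst (_≤ _) (SameOrder-length so) (length-mono-≤ (infix-⊆ {pre = pre} {suf = suf} e))

-- Standardisation

count< : ℕ → List ℕ → ℕ
count< a []      = 0
count< a (x ∷ l) with x <? a
... | yes _ = suc (count< a l)
... | no  _ = count< a l

count<-≤-length : ∀ a l → count< a l ≤ length l
count<-≤-length a []      = z≤n
count<-≤-length a (x ∷ l) with x <? a
... | yes _ = s≤s (count<-≤-length a l)
... | no  _ = m≤n⇒m≤1+n (count<-≤-length a l)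

count<-mono : ∀ {a b} l → a ≤ b → count< a l ≤ count< b l
count<-mono []               a≤b = z≤n
count<-mono {a} {b} (x ∷ l) a≤b with x <? a | x <? b
... | yes _   | yes _   = s≤s (count<-mono l a≤b)
... | yes x<a | no  x≮b = ⊥-elim (x≮b (<-≤-trans x<a a≤b))
... | no  _   | yes _   = m≤n⇒m≤1+n (count<-mono l a≤b)
... | no  _   | no  _   = count<-mono l a≤b

count<-strict : ∀ {a b l} → a ∈ l → a < b → count< a l < count< b l
count<-strict {a} {b} {x ∷ l} (here refl) a<b with x <? a | x <? b
... | yes x<x | _       = ⊥-elim (<-irrefl refl x<x)
... | no  _   | yes _   = s≤s (count<-mono l (<⇒≤ a<b))
... | no  _   | no  x≮b = ⊥-elim (x≮b a<b)
count<-strict {a} {b} {x ∷ l} (there a∈l) a<b with x <? a | x <? b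
... | yes _   | yes _   = s≤s (count<-strict a∈l a<b)
... | yes x<a | no  x≮b = ⊥-elim (x≮b (<-trans x<a a<b))
... | no  _   | yes _   = m≤n⇒m≤1+n (count<-strict a∈l a<b)
... | no  _   | no  _   = count<-strict a∈l a<b

rank : List ℕ → ℕ → ℕ
rank l a = suc (count< a l)

rank-strict : ∀ l {a b} → a ∈ l → b ∈ l → a < b → rank l a < rank l b
rank-strict l a∈l _ a<b = s≤s (count<-strict a∈l a<b)

StrictlyMonotoneOn : List ℕ → (ℕ → ℕ) → Set
StrictlyMonotoneOn l f = ∀ {a b} → a ∈ l → b ∈ l → a < b → f a < f b

StrictlyMonotoneOn-<⇔ : ∀ {l f a b} → StrictlyMonotoneOn l f → a ∈ l → b ∈ l → (a < b ⇔ f a < f b)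
StrictlyMonotoneOn-<⇔ {f = f} {a} {b} mono a∈l b∈l = mk⇔ (mono a∈l b∈l) λ fa<fb → case <-cmp a b of λ
  { (tri< a<b _ _) → a<b
  ; (tri≈ _ refl _) → ⊥-elim (<-irrefl refl fa<fb)
  ; (tri> _ _ b<a) → ⊥-elim (<-asym fa<fb (mono b∈l a∈l b<a)) }

SameOrder-map : ∀ {f} l → StrictlyMonotoneOn l f → SameOrder l (map f l)
SameOrder-map []                mono = []
SameOrder-map {f} (x ∷ l) mono = head-order there ∷ SameOrder-map l (λ a∈ b∈ → mono (there a∈) (there b∈))
  where
    head-order : ∀ {m} → (∀ {b} → b ∈ m → b ∈ x ∷ l) → Pointwise (λ a b → (x < a) ⇔ (f x < b)) m (map f m)
    head-order {[]}    _   = []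
    head-order {a ∷ m} inj = StrictlyMonotoneOn-<⇔ mono (here refl) (inj (here refl)) ∷ head-order (λ b∈ → inj (there b∈))

range : ℕ → ℕ → List ℕ
range = iterate suc

range-++ : ∀ a m k → range a (m + k) ≡ range a m ++ range (a + m) k
range-++ a zero    k = cong (λ b → range b k) (sym (+-identityʳ a))
range-++ a (suc m) k = cong (a ∷_) (trans (range-++ (suc a) m k) (cong (λ b → range (suc a) m ++ range b k) (sym (+-suc a m))))

applyUpTo-range : ∀ (g : ℕ → ℕ) a n → (∀ i → g i ≡ a + i) → applyUpTo g n ≡ range a n
applyUpTo-range g a zero    _ = refl
applyUpTo-range g a (suc n) e =
  cong₂ _∷_ (trans (e 0) (+-identityʳ a)) (applyUpTo-range (λ i → g (suc i)) (suc a) n (λ i → trans (e (suc i)) (+-suc a i)))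

map-suc-upTo : ∀ n → map suc (upTo n) ≡ range 1 n
map-suc-upTo n = trans (map-applyUpTo (λ i → i) suc n) (applyUpTo-range suc 1 n (λ _ → refl))

map-suc-range : ∀ a n → map suc (range a n) ≡ range (suc a) n
map-suc-range a zero    = refl
map-suc-range a (suc n) = cong (suc a ∷_) (map-suc-range (suc a) n)

∈-range⁻ : ∀ {x} a n → x ∈ range a n → a ≤ x × x < a + n
∈-range⁻ a (suc n) (here refl) = ≤-refl , m<m+n a (s≤s z≤n)
∈-range⁻ {x} a (suc n) (there x∈) with ∈-range⁻ (suc a) n x∈
... | a<x , x<a+n = <⇒≤ a<x , subst (x <_) (sym (+-suc a n)) x<a+n

∈-range⁺ : ∀ {x} a n → a ≤ x → x < a + n → x ∈ range a n
∈-range⁺ {x} a zero    a≤x x<a = ⊥-elim (<-irrefl refl (<-≤-trans x<a (subst (_≤ x) (sym (+-identityʳ a)) a≤x)))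
∈-range⁺ {x} a (suc n) a≤x x<a+n with a ≟ x
... | yes refl = here refl
... | no  a≢x  = there (∈-range⁺ (suc a) n (≤∧≢⇒< a≤x a≢x) (subst (x <_) (+-suc a n) x<a+n))

Unique-range : ∀ a n → Unique (range a n)
Unique-range a zero    = []
Unique-range a (suc n) =
  All.tabulate (λ x∈ a≡x → <-irrefl a≡x (proj₁ (∈-range⁻ (suc a) n x∈))) ∷ Unique-range (suc a) n

bumpFrom : ℕ → ℕ → ℕ
bumpFrom t b with b <? t
... | yes _ = b
... | no  _ = suc b

bumpFrom-< : ∀ {t b} → b < t → bumpFrom t b ≡ b
bumpFrom-< {t} {b} b<t with b <? t
... | yes _   = refl
... | no  b≮t = ⊥-elim (b≮t b<t)

bumpFrom-≥ : ∀ {t b} → t ≤ b → bumpFrom t b ≡ suc b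
bumpFrom-≥ {t} {b} t≤b with b <? t
... | yes b<t = ⊥-elim (<-irrefl refl (<-≤-trans b<t t≤b))
... | no  _   = refl

bumpFrom-strict : ∀ {t b c} → b < c → bumpFrom t b < bumpFrom t c
bumpFrom-strict {t} {b} {c} b<c with b <? t | c <? t
... | yes _   | yes _   = b<c
... | yes _   | no  _   = m<n⇒m<1+n b<c
... | no  b≮t | yes c<t = ⊥-elim (b≮t (<-trans b<c c<t))
... | no  _   | no  _   = s≤s b<c

map-bumpFrom-below : ∀ t a m → a + m ≤ t → map (bumpFrom t) (range a m) ≡ range a m
map-bumpFrom-below t a zero    _ = refl
map-bumpFrom-below t a (suc m) le =
  cong₂ _∷_ (bumpFrom-< (<-≤-trans (m<m+n a (s≤s z≤n)) le))
            (map-bumpFrom-below t (suc a) m (subst (_≤ t) (+-suc a m) le))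

map-bumpFrom-above : ∀ t a m → t ≤ a → map (bumpFrom t) (range a m) ≡ range (suc a) m
map-bumpFrom-above t a zero    _   = refl
map-bumpFrom-above t a (suc m) t≤a = cong₂ _∷_ (bumpFrom-≥ t≤a) (map-bumpFrom-above t (suc a) m (m≤n⇒m≤1+n t≤a))

range-insert : ∀ r n → r ≤ n → suc r ∷ map (bumpFrom (suc r)) (range 1 n) ↭ range 1 (suc n)
range-insert r n r≤n =
  subst₂ (λ u v → suc r ∷ u ↭ v) (sym bumped) (sym whole) (↭-sym (shift (suc r) (range 1 r) high))
  where
    d    = n ∸ r
    high = range (suc (suc r)) d
    r+d≡n : r + d ≡ n
    r+d≡n = m+[n∸m]≡n r≤n
    bumped : map (bumpFrom (suc r)) (range 1 n) ≡ range 1 r ++ high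
    bumped = begin
      map (bumpFrom (suc r)) (range 1 n)                ≡⟨ cong (λ k → map (bumpFrom (suc r)) (range 1 k)) (sym r+d≡n) ⟩
      map (bumpFrom (suc r)) (range 1 (r + d))          ≡⟨ cong (map (bumpFrom (suc r))) (range-++ 1 r d) ⟩
      map (bumpFrom (suc r)) (range 1 r ++ range (suc r) d) ≡⟨ map-++ (bumpFrom (suc r)) (range 1 r) (range (suc r) d) ⟩
      map (bumpFrom (suc r)) (range 1 r) ++ map (bumpFrom (suc r)) (range (suc r) d)
        ≡⟨ cong₂ _++_ (map-bumpFrom-below (suc r) 1 r ≤-refl) (map-bumpFrom-above (suc r) (suc r) d ≤-refl) ⟩
      range 1 r ++ high ∎
      where open ≡-Reasoning
    whole : range 1 (suc n) ≡ range 1 r ++ suc r ∷ high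
    whole = trans (cong (range 1) (sym (trans (+-suc r d) (cong suc r+d≡n)))) (range-++ 1 r (suc d))

IsPerm⇒↭range : ∀ {σ} → IsPerm σ → σ ↭ range 1 (length σ)
IsPerm⇒↭range {σ} σ-perm = subst (σ ↭_) (map-suc-upTo (length σ)) σ-perm

↭range⇒IsPerm : ∀ {l n} → l ↭ range 1 n → IsPerm l
↭range⇒IsPerm {l} {n} p =
  subst (l ↭_) (sym (trans (cong (λ k → map suc (upTo k)) (trans (↭-length p) (length-iterate suc 1 n))) (map-suc-upTo n))) p

IsPerm-resp-↭ : ∀ {π o} → o ↭ π → IsPerm π → IsPerm o
IsPerm-resp-↭ p π-perm = ↭range⇒IsPerm (↭-trans p (IsPerm⇒↭range π-perm))

Unique-resp-↭ : ∀ {l m : List ℕ} → l ↭ m → Unique l → Unique m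
Unique-resp-↭ p = PermutationSetoid.Unique-resp-↭ (setoid ℕ) (↭⇒↭ₛ p)

Unique-resp-⊆ : ∀ {s l : List ℕ} → s ⊆ l → Unique l → Unique s
Unique-resp-⊆ []         []        = []
Unique-resp-⊆ (_ ∷ʳ p)   (_ ∷ u)   = Unique-resp-⊆ p u
Unique-resp-⊆ (refl ∷ p) (x∉l ∷ u) = All-resp-⊆ p x∉l ∷ Unique-resp-⊆ p u

Unique-head : ∀ {a : ℕ} {l} → Unique (a ∷ l) → All (λ b → ¬ a ≡ b) l
Unique-head (a∉l ∷ _) = a∉l

IsPerm⇒Unique : ∀ {π} → IsPerm π → Unique π
IsPerm⇒Unique π-perm = Unique-resp-↭ (↭-sym (IsPerm⇒↭range π-perm)) (Unique-range 1 _)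

∈-IsPerm⁻ : ∀ {σ a} → IsPerm σ → a ∈ σ → 1 ≤ a × a ≤ length σ
∈-IsPerm⁻ {σ} σ-perm a∈σ with ∈-range⁻ 1 (length σ) (∈-resp-↭ (IsPerm⇒↭range σ-perm) a∈σ)
... | 1≤a , a<1+k = 1≤a , ≤-pred a<1+k

∈-IsPerm⁺ : ∀ {σ a} → IsPerm σ → 1 ≤ a → a ≤ length σ → a ∈ σ
∈-IsPerm⁺ {σ} σ-perm 1≤a a≤k =
  ∈-resp-↭ (↭-sym (IsPerm⇒↭range σ-perm)) (∈-range⁺ 1 (length σ) 1≤a (s≤s a≤k))

IsPerm-minimum : ∀ {σ a} → IsPerm σ → a ∈ σ → (∀ {b} → b ∈ σ → a ≤ b) → a ≡ 1
IsPerm-minimum σ-perm a∈σ least with ∈-IsPerm⁻ σ-perm a∈σ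
... | 1≤a , a≤k = ≤-antisym (least (∈-IsPerm⁺ σ-perm ≤-refl (≤-trans 1≤a a≤k))) 1≤a

IsPerm-maximum : ∀ {σ a} → IsPerm σ → a ∈ σ → (∀ {b} → b ∈ σ → b ≤ a) → a ≡ length σ
IsPerm-maximum σ-perm a∈σ greatest with ∈-IsPerm⁻ σ-perm a∈σ
... | 1≤a , a≤k = ≤-antisym a≤k (greatest (∈-IsPerm⁺ σ-perm (≤-trans 1≤a a≤k) ≤-refl))

rank-∷-self : ∀ x l → rank (x ∷ l) x ≡ rank l x
rank-∷-self x l with x <? x
... | yes x<x = ⊥-elim (<-irrefl refl x<x)
... | no  _   = refl

rank-∷ : ∀ x l {a} → a ∈ l → ¬ x ≡ a → rank (x ∷ l) a ≡ bumpFrom (rank l x) (rank l a)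
rank-∷ x l {a} a∈l x≢a with x <? a
... | yes x<a = sym (bumpFrom-≥ (s≤s (count<-mono l (<⇒≤ x<a))))
... | no  x≮a = sym (bumpFrom-< (s≤s (count<-strict a∈l (≤∧≢⇒< (≮⇒≥ x≮a) (λ a≡x → x≢a (sym a≡x))))))

map-cong-∈ : ∀ {f g : ℕ → ℕ} l → (∀ {a} → a ∈ l → f a ≡ g a) → map f l ≡ map g l
map-cong-∈ []      _ = refl
map-cong-∈ (y ∷ l) e = cong₂ _∷_ (e (here refl)) (map-cong-∈ l (λ a∈ → e (there a∈)))

map-rank-↭ : ∀ l → Unique l → map (rank l) l ↭ range 1 (length l)
map-rank-↭ []      _           = ↭-refl
map-rank-↭ (x ∷ l) (x∉l ∷ l-u) = begin
  rank (x ∷ l) x ∷ map (rank (x ∷ l)) l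
    ≡⟨ cong₂ _∷_ (rank-∷-self x l) ranks-tail ⟩
  rank l x ∷ map (bumpFrom (rank l x)) (map (rank l) l)
    ↭⟨ prep (rank l x) (map⁺ (bumpFrom (rank l x)) (map-rank-↭ l l-u)) ⟩
  rank l x ∷ map (bumpFrom (rank l x)) (range 1 (length l))
    ↭⟨ range-insert (count< x l) (length l) (count<-≤-length x l) ⟩
  range 1 (suc (length l))
    ∎
  where
    open PermutationReasoning
    ranks-tail : map (rank (x ∷ l)) l ≡ map (bumpFrom (rank l x)) (map (rank l) l)
    ranks-tail = trans (map-cong-∈ l (λ a∈l → rank-∷ x l a∈l (All.lookup x∉l a∈l))) (map-∘ l)

standardise : ∀ {l} → Unique l → ∃[ α ] (IsPerm α × SameOrder l α)
standardise {l} l-u =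
  map (rank l) l ,
  ↭range⇒IsPerm (map-rank-↭ l l-u) ,
  SameOrder-map l (rank-strict l)

-- The stack machine

reverse-∷-++ : ∀ (x : ℕ) xs st → reverse xs ++ x ∷ st ≡ reverse (x ∷ xs) ++ st
reverse-∷-++ x xs st = sym (trans (cong (_++ st) (unfold-reverse x xs)) (∷ʳ-++ (reverse xs) x st))

module _ {𝒜 : PermSet} where

  Run-↭ : ∀ {inp st out} → Run 𝒜 inp st out → out ↭ inp ++ st
  Run-↭ stop                          = ↭-refl
  Run-↭ {x ∷ xs} {st} (push _ r)      = ↭-trans (Run-↭ r) (shift x xs st)
  Run-↭ {inp} {y ∷ st} (pop _ r)      = ↭-trans (prep y (Run-↭ r)) (↭-sym (shift y inp st))

  Run-stack-⊆ : ∀ {inp st out} → Run 𝒜 inp st out → st ⊆ out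
  Run-stack-⊆ stop       = []
  Run-stack-⊆ (push _ r) = ⊆-trans (_ ∷ʳ ⊆-refl) (Run-stack-⊆ r)
  Run-stack-⊆ (pop _ r)  = refl ∷ Run-stack-⊆ r

  Run-deterministic : ∀ {inp st o₁ o₂} → Run 𝒜 inp st o₁ → Run 𝒜 inp st o₂ → o₁ ≡ o₂
  Run-deterministic stop       stop       = refl
  Run-deterministic (push _ r) (push _ s) = Run-deterministic r s
  Run-deterministic (push c _) (pop n _)  = ⊥-elim (n c)
  Run-deterministic (pop n _)  (push c _) = ⊥-elim (n c)
  Run-deterministic (pop _ r)  (pop _ s)  = cong (_ ∷_) (Run-deterministic r s)

  T-IsPerm : ∀ {π o} → T 𝒜 π o → IsPerm π → IsPerm o
  T-IsPerm {π} r = IsPerm-resp-↭ (subst (_ ↭_) (++-identityʳ π) (Run-↭ r))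

  popAll : ∀ st → Run 𝒜 [] st st
  popAll []       = stop
  popAll (y ∷ st) = pop tt (popAll st)

  pushAll : ∀ xs st {rest out} → (∀ {l} → l ⊆ reverse xs ++ st → CanPush 𝒜 l) →
            Run 𝒜 rest (reverse xs ++ st) out → Run 𝒜 (xs ++ rest) st out
  pushAll []       st can r = r
  pushAll (x ∷ xs) st {rest} {out} can r =
    push (can (subst ((x ∷ st) ⊆_) (reverse-∷-++ x xs st) (++⁺ˡ (reverse xs) ⊆-refl)))
         (pushAll xs (x ∷ st) (λ p → can (subst (_ ⊆_) (reverse-∷-++ x xs st) p))
                  (subst (λ t → Run 𝒜 rest t out) (sym (reverse-∷-++ x xs st)) r))

  pushAll-reverse : ∀ ys {rest out} → (∀ {l} → l ⊆ ys → CanPush 𝒜 l) →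
                    Run 𝒜 rest ys out → Run 𝒜 (reverse ys ++ rest) [] out
  pushAll-reverse ys {rest} {out} can r =
    pushAll (reverse ys) []
      (λ p → can (subst (_ ⊆_) (trans (++-identityʳ _) (reverse-involutive ys)) p))
      (subst (λ t → Run 𝒜 rest t out) (sym (trans (++-identityʳ _) (reverse-involutive ys))) r)

Unique-push : ∀ {x xs st} → Unique ((x ∷ xs) ++ st) → Unique (xs ++ x ∷ st)
Unique-push {x} {xs} {st} = Unique-resp-↭ (↭-sym (shift x xs st))

Unique-pop : ∀ {inp y st} → Unique (inp ++ y ∷ st) → Unique (inp ++ st)
Unique-pop {inp} = Unique-resp-⊆ (⊆-++⁺ (⊆-refl {x = inp}) (_ ∷ʳ ⊆-refl))

Unique-next : ∀ {x xs st} → Unique ((x ∷ xs) ++ st) → Unique (x ∷ st)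
Unique-next {xs = xs} = Unique-resp-⊆ (refl ∷ ++⁺ˡ xs ⊆-refl)

module _ {σ : List ℕ} where

  canPush : ∀ {l} → Unique l → ¬ ContainsConsec l σ → CanPush (AvConsec σ) l
  canPush l-u l∌σ with standardise l-u
  ... | α , α-perm , l≅α =
    α , (α-perm , λ α∋σ → l∌σ (ContainsConsec-resp-SameOrder α∋σ (SameOrder-sym l≅α))) , l≅α

  cannotPush : ∀ {l} → ContainsConsec l σ → ¬ CanPush (AvConsec σ) l
  cannotPush l∋σ (α , (_ , α∌σ) , l≅α) = α∌σ (ContainsConsec-resp-SameOrder l∋σ l≅α)

  ¬CanPush⇒ContainsConsec : ∀ {l} → Unique l → ¬ CanPush (AvConsec σ) l → ContainsConsec l σ
  ¬CanPush⇒ContainsConsec {l} l-u ¬push with ContainsConsec? l σ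
  ... | yes l∋σ = l∋σ
  ... | no  l∌σ = ⊥-elim (¬push (canPush l-u l∌σ))

  canPush-short : ∀ {l} → Unique l → length l < length σ → CanPush (AvConsec σ) l
  canPush-short l-u l<σ = canPush l-u (λ l∋σ → <-irrefl refl (<-≤-trans l<σ (ContainsConsec-length l∋σ)))

  -- As |σ| ≥ 2, a single entry can always be pushed onto the empty stack, so the machine never stalls.
  run : 2 ≤ length σ → ∀ inp st → Unique (inp ++ st) → ∃[ out ] Run (AvConsec σ) inp st out
  run _  []       st _ = st , popAll st
  run 2≤σ (x ∷ xs) st u = go st u
    where
      go : ∀ st → Unique (x ∷ xs ++ st) → ∃[ out ] Run (AvConsec σ) (x ∷ xs) st out
      go st u with ContainsConsec? (x ∷ st) σ
      ... | no  x∷st∌σ = let out , r = run 2≤σ xs (x ∷ st) (Unique-push {x} {xs} u)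
                         in out , push (canPush (Unique-next {x} {xs} u) x∷st∌σ) r
      go []       u | yes x∋σ = ⊥-elim (<-irrefl refl (<-≤-trans (s≤s 2≤σ) (s≤s (ContainsConsec-length x∋σ))))
      go (y ∷ st) u | yes x∷st∋σ = let out , r = go st (Unique-pop {x ∷ xs} u) in y ∷ out , pop (cannotPush x∷st∋σ) r

-- σ and σ̂ both containing 231

≢∧≮⇒> : ∀ {a b} → ¬ a ≡ b → ¬ a < b → b < a
≢∧≮⇒> a≢b a≮b = ≤∧≢⇒< (≮⇒≥ a≮b) (λ b≡a → a≢b (sym b≡a))

Unique₃ : ∀ {x y z : ℕ} {l} → Unique l → (x ∷ y ∷ z ∷ []) ⊆ l → ¬ x ≡ y × ¬ x ≡ z × ¬ y ≡ z
Unique₃ l-u p with Unique-resp-⊆ p l-u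
... | (x≢y ∷ x≢z ∷ []) ∷ (y≢z ∷ []) ∷ _ = x≢y , x≢z , y≢z

⊆-reverse₃ : ∀ {a b c : ℕ} {l} → (a ∷ b ∷ c ∷ []) ⊆ reverse l → (c ∷ b ∷ a ∷ []) ⊆ l
⊆-reverse₃ {l = l} p = subst (_ ⊆_) (reverse-involutive l) (reverse⁺ p)

Has231-reverse⇒Has132 : ∀ {l} → Unique l → Has231 (reverse l) → Has132 l
Has231-reverse⇒Has132 l-u rl∋231 with has231⁻ rl∋231
... | b , c , a , p , b<c , b≮a , _ with Unique₃ l-u (⊆-reverse₃ p)
... | _ , a≢b , _ = has132 (⊆-reverse₃ p) (≢∧≮⇒> (λ b≡a → a≢b (sym b≡a)) b≮a) b<c

Has132⇒Has231-reverse : ∀ {l} → Unique l → Has132 l → Has231 (reverse l)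
Has132⇒Has231-reverse l-u l∋132 with has132⁻ l∋132
... | a , c , b , p , _ , a<b , c≮b with Unique₃ l-u p
... | _ , _ , c≢b = has231 (reverse⁺ p) (≢∧≮⇒> c≢b c≮b) a<b

ContainsConsec⇒Has231 : ∀ {l σ} → Has231 σ → ContainsConsec l σ → Has231 l
ContainsConsec⇒Has231 σ∋231 l∋σ = Contains-trans (ContainsConsec⇒Contains l∋σ) σ∋231

-- Every stack is a subsequence of reverse π, hence avoids 231 and therefore σ:
-- SC_σ pushes all of π and outputs reverse π.
Av132⇒Sort : ∀ σ → Has231 σ → ∀ π → Av (1 ∷ 3 ∷ 2 ∷ []) π → Sort σ π
Av132⇒Sort σ σ∋231 π (π-perm , π∌132) =
  π-perm , reverse π ,
  subst (λ t → Run (AvConsec σ) t [] (reverse π)) (trans (++-identityʳ _) (reverse-involutive π))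
        (pushAll-reverse (reverse π) canPush-all (popAll _)) ,
  IsPerm-resp-↭ (↭-reverse π) π-perm ,
  λ rπ∋231 → π∌132 (Has231-reverse⇒Has132 π-u rπ∋231)
  where
    π-u = IsPerm⇒Unique π-perm
    canPush-all : ∀ {l} → l ⊆ reverse π → CanPush (AvConsec σ) l
    canPush-all p = canPush (Unique-resp-⊆ p (Unique-resp-↭ (↭-sym (↭-reverse π)) π-u))
      (λ l∋σ → π∌132 (Has231-reverse⇒Has132 π-u (Contains-resp-⊆ p (ContainsConsec⇒Has231 σ∋231 l∋σ))))

SameOrder-swap : ∀ {a b c d l m} → ¬ a ≡ b → ¬ c ≡ d →
                 SameOrder (a ∷ b ∷ l) (c ∷ d ∷ m) → SameOrder (b ∷ a ∷ l) (d ∷ c ∷ m)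
SameOrder-swap a≢b c≢d ((a<b⇔c<d ∷ pa) ∷ (pb ∷ so)) =
  (mk⇔ (λ b<a → ≢∧≮⇒> c≢d (λ c<d → <-asym b<a (from a<b⇔c<d c<d)))
       (λ d<c → ≢∧≮⇒> a≢b (λ a<b → <-asym d<c (to a<b⇔c<d a<b))) ∷ pb) ∷ (pa ∷ so)

module BothContain231 (σ₁ σ₂ : ℕ) (ρ : List ℕ) (σ₁≢σ₂ : ¬ σ₁ ≡ σ₂)
                      (σ∋231 : Has231 (σ₁ ∷ σ₂ ∷ ρ)) (σ̂∋231 : Has231 (σ₂ ∷ σ₁ ∷ ρ)) where

  σ : List ℕ
  σ = σ₁ ∷ σ₂ ∷ ρ

  -- An occurrence of σ in x z st either lies in z st, or starts at x, and then z x … is an occurrence of σ̂.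
  blocked⇒Has231 : ∀ {x z st} → ¬ x ≡ z → ContainsConsec (x ∷ z ∷ st) σ → Has231 (z ∷ x ∷ st)
  blocked⇒Has231 {x} {z} {st} x≢z x∷z∷st∋σ with ContainsConsec-∷⁻ x∷z∷st∋σ
  ... | inj₂ z∷st∋σ = Contains-resp-⊆ (refl ∷ (x ∷ʳ ⊆-refl)) (ContainsConsec⇒Has231 σ∋231 z∷st∋σ)
  ... | inj₁ start =
        Contains-resp-⊆ (refl ∷ refl ∷ take-⊆ (length ρ) st)
          (Contains-resp-SameOrder (SameOrder-sym (SameOrder-swap x≢z σ₁≢σ₂ start)) σ̂∋231)

  -- z was popped because x could not be pushed onto z st; whatever happens next, z is followed in the
  -- output by x st (if x is pushed later) or by another such refused pop.
  refused⇒Has231 : ∀ {x xs st out} → Run (AvConsec σ) (x ∷ xs) st out → Unique ((x ∷ xs) ++ st) →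
                   ∀ z → Unique (x ∷ z ∷ st) → ¬ CanPush (AvConsec σ) (x ∷ z ∷ st) → Has231 (z ∷ out)
  refused⇒Has231 (push _ r) _ z u@((x≢z ∷ _) ∷ _) ¬push =
    Contains-resp-⊆ (refl ∷ Run-stack-⊆ r) (blocked⇒Has231 x≢z (¬CanPush⇒ContainsConsec u ¬push))
  refused⇒Has231 {x} {xs} (pop {y = y} ¬push′ r) u z _ _ =
    Contains-resp-⊆ (z ∷ʳ ⊆-refl) (refused⇒Has231 r (Unique-pop {x ∷ xs} u) y (Unique-next {x} {xs} u) ¬push′)

  Run⇒Has231⊎reverse : ∀ {inp st out} → Run (AvConsec σ) inp st out → Unique (inp ++ st) →
                       Has231 out ⊎ out ≡ reverse inp ++ st
  Run⇒Has231⊎reverse stop _ = inj₂ refl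
  Run⇒Has231⊎reverse {x ∷ xs} {st} (push _ r) u with Run⇒Has231⊎reverse r (Unique-push {x} {xs} u)
  ... | inj₁ out∋231 = inj₁ out∋231
  ... | inj₂ e       = inj₂ (trans e (reverse-∷-++ x xs st))
  Run⇒Has231⊎reverse {[]} (pop _ r) u with Run⇒Has231⊎reverse r (Unique-pop {[]} u)
  ... | inj₁ out∋231 = inj₁ (Contains-resp-⊆ (_ ∷ʳ ⊆-refl) out∋231)
  ... | inj₂ e       = inj₂ (cong (_ ∷_) e)
  Run⇒Has231⊎reverse {x ∷ xs} (pop {y = y} ¬push r) u =
    inj₁ (refused⇒Has231 r (Unique-pop {x ∷ xs} u) y (Unique-next {x} {xs} u) ¬push)

  Sort⇒Av132 : ∀ π → Sort σ π → Av (1 ∷ 3 ∷ 2 ∷ []) π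
  Sort⇒Av132 π (π-perm , out , r , _ , out∌231) = π-perm , π∌132
    where
      π-u = IsPerm⇒Unique π-perm
      π∌132 : ¬ Has132 π
      π∌132 π∋132 with Run⇒Has231⊎reverse r (subst Unique (sym (++-identityʳ π)) π-u)
      ... | inj₁ out∋231 = out∌231 out∋231
      ... | inj₂ out≡rπ  =
            out∌231 (subst Has231 (sym (trans out≡rπ (++-identityʳ _))) (Has132⇒Has231-reverse π-u π∋132))

-- σ = 12

𝒜₁₂ : PermSet
𝒜₁₂ = AvConsec (1 ∷ 2 ∷ [])

NoAscent : List ℕ → Set
NoAscent = Linked (λ x y → ¬ x < y)

ascent⇒ContainsConsec : ∀ {x y st} → x < y → ContainsConsec (x ∷ y ∷ st) (1 ∷ 2 ∷ [])
ascent⇒ContainsConsec x<y = OccursAtStart⇒ContainsConsec (sameOrder₂ (⇔-both x<y 1<2))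

NoAscent⇒¬ContainsConsec : ∀ {l} → NoAscent l → ¬ ContainsConsec l (1 ∷ 2 ∷ [])
NoAscent⇒¬ContainsConsec [] c = case ContainsConsec-[]⁻ c of λ ()
NoAscent⇒¬ContainsConsec [-] c with ContainsConsec-∷⁻ c
... | inj₁ (_ ∷ ())
... | inj₂ c′ = case ContainsConsec-[]⁻ c′ of λ ()
NoAscent⇒¬ContainsConsec (x≮y ∷ l↓) c with ContainsConsec-∷⁻ c
... | inj₁ ((e ∷ []) ∷ _) = x≮y (from e 1<2)
... | inj₂ c′            = NoAscent⇒¬ContainsConsec l↓ c′

¬ContainsConsec⇒NoAscent : ∀ l → ¬ ContainsConsec l (1 ∷ 2 ∷ []) → NoAscent l
¬ContainsConsec⇒NoAscent []          _   = []
¬ContainsConsec⇒NoAscent (x ∷ [])    _   = [-]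
¬ContainsConsec⇒NoAscent (x ∷ y ∷ l) l∌ =
  (λ x<y → l∌ (ascent⇒ContainsConsec x<y)) ∷ ¬ContainsConsec⇒NoAscent (y ∷ l) (λ c → l∌ (ContainsConsec-∷⁺ c))

CanPush₁₂⇒NoAscent : ∀ {l} → CanPush 𝒜₁₂ l → NoAscent l
CanPush₁₂⇒NoAscent {l} l-ok = ¬ContainsConsec⇒NoAscent l (λ c → cannotPush c l-ok)

NoAscent-∷ʳ : ∀ {m} l → NoAscent l → All (m <_) l → NoAscent (l ++ [ m ])
NoAscent-∷ʳ []          _           _            = [-]
NoAscent-∷ʳ (x ∷ [])    _           (m<x ∷ [])   = (λ x<m → <-asym x<m m<x) ∷ [-]
NoAscent-∷ʳ (x ∷ y ∷ l) (x≮y ∷ l↓) (_ ∷ m<l)    = x≮y ∷ NoAscent-∷ʳ (y ∷ l) l↓ m<l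

NoAscent-++⁻ˡ : ∀ l {l′} → NoAscent (l ++ l′) → NoAscent l
NoAscent-++⁻ˡ []          _           = []
NoAscent-++⁻ˡ (x ∷ [])    _           = [-]
NoAscent-++⁻ˡ (x ∷ y ∷ l) (x≮y ∷ l↓) = x≮y ∷ NoAscent-++⁻ˡ (y ∷ l) l↓

-- While L is processed every entry of the stack exceeds m, so m cannot be pushed before the stack is empty.
Run₁₂-before-minimum : ∀ {L st oL m R o} → Run 𝒜₁₂ L st oL → All (m <_) (L ++ st) → Run 𝒜₁₂ (m ∷ R) [] o →
                       Run 𝒜₁₂ (L ++ m ∷ R) st (oL ++ o)
Run₁₂-before-minimum stop _ r = r
Run₁₂-before-minimum {x ∷ xs} {st} (push c r) m<L r′ =
  push c (Run₁₂-before-minimum r (All-resp-↭ (↭-sym (shift x xs st)) m<L) r′)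
Run₁₂-before-minimum {[]} (pop _ r) (m<y ∷ m<st) r′ =
  pop (cannotPush (ascent⇒ContainsConsec m<y)) (Run₁₂-before-minimum r m<st r′)
Run₁₂-before-minimum {x ∷ xs} {y ∷ st} (pop ¬push r) m<L r′ =
  pop ¬push (Run₁₂-before-minimum r (All-resp-⊆ (⊆-++⁺ (⊆-refl {x = x ∷ xs}) (y ∷ʳ ⊆-refl)) m<L) r′)

-- A minimum m at the bottom of the stack never blocks a push, so it is output last.
Run₁₂-above-minimum : ∀ {R st oR m} → Run 𝒜₁₂ R st oR → All (m <_) (R ++ st) → Unique (R ++ st ++ [ m ]) →
                      Run 𝒜₁₂ R (st ++ [ m ]) (oR ++ [ m ])
Run₁₂-above-minimum stop _ _ = pop tt stop
Run₁₂-above-minimum {x ∷ xs} {st} {m = m} (push c r) m<R u =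
  push (canPush (Unique-resp-⊆ (refl ∷ ++⁺ˡ xs ⊆-refl) u)
         (NoAscent⇒¬ContainsConsec
           (NoAscent-∷ʳ (x ∷ st) (CanPush₁₂⇒NoAscent c) (All-resp-⊆ (refl ∷ ++⁺ˡ xs ⊆-refl) m<R))))
       (Run₁₂-above-minimum r (All-resp-↭ (↭-sym (shift x xs st)) m<R) (Unique-resp-↭ (↭-sym (shift x xs (st ++ [ m ]))) u))
Run₁₂-above-minimum {[]} {y ∷ st} (pop _ r) (_ ∷ m<st) (_ ∷ u) = pop tt (Run₁₂-above-minimum r m<st u)
Run₁₂-above-minimum {x ∷ xs} {y ∷ st} {m = m} (pop ¬push r) m<R u =
  pop (λ l-ok → ¬push (canPush (Unique-resp-⊆ (refl ∷ ++⁺ˡ xs (refl ∷ ++⁺ʳ [ m ] ⊆-refl)) u)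
                          (NoAscent⇒¬ContainsConsec (NoAscent-++⁻ˡ (x ∷ y ∷ st) (CanPush₁₂⇒NoAscent l-ok)))))
      (Run₁₂-above-minimum r (All-resp-⊆ drop-y m<R) (Unique-resp-⊆ drop-y u))
  where
    drop-y : ∀ {l} → (x ∷ xs) ++ l ⊆ (x ∷ xs) ++ y ∷ l
    drop-y = ⊆-++⁺ (⊆-refl {x = x ∷ xs}) (y ∷ʳ ⊆-refl)

Run₁₂-split : ∀ {L m R oL oR} → T 𝒜₁₂ L oL → T 𝒜₁₂ R oR → All (m <_) (L ++ R) → Unique (R ++ [ m ]) →
              T 𝒜₁₂ (L ++ m ∷ R) (oL ++ oR ++ [ m ])
Run₁₂-split {L} {m} {R} rL rR m<LR u =
  Run₁₂-before-minimum rL (subst (All (m <_)) (sym (++-identityʳ L)) (++⁻ˡ L m<LR))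
    (push (canPush-short ([] ∷ []) (s≤s (s≤s z≤n)))
      (Run₁₂-above-minimum rR (subst (All (m <_)) (sym (++-identityʳ R)) (++⁻ʳ L m<LR)) u))

⊆-++⁻ : ∀ (A : List ℕ) {B s} → s ⊆ A ++ B → ∃[ s₁ ] ∃[ s₂ ] (s ≡ s₁ ++ s₂ × s₁ ⊆ A × s₂ ⊆ B)
⊆-++⁻ []      p          = [] , _ , refl , [] , p
⊆-++⁻ (a ∷ A) (.a ∷ʳ p) with ⊆-++⁻ A p
... | s₁ , s₂ , e , p₁ , p₂ = s₁ , s₂ , e , a ∷ʳ p₁ , p₂
⊆-++⁻ (a ∷ A) (refl ∷ p) with ⊆-++⁻ A p
... | s₁ , s₂ , refl , p₁ , p₂ = a ∷ s₁ , s₂ , refl , refl ∷ p₁ , p₂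

Cross : List ℕ → List ℕ → Set
Cross A B = ∃[ x ] ∃[ y ] (x ∈ A × y ∈ B × x < y)

Cross-resp-↭ : ∀ {A A′ B B′} → A ↭ A′ → B ↭ B′ → Cross A B → Cross A′ B′
Cross-resp-↭ A↭A′ B↭B′ (x , y , x∈A , y∈B , x<y) = x , y , ∈-resp-↭ A↭A′ x∈A , ∈-resp-↭ B↭B′ y∈B , x<y

Has12-++ : ∀ A {B} → Has12 (A ++ B) ⇔ (Has12 A ⊎ Has12 B ⊎ Cross A B)
Has12-++ A {B} = mk⇔ split join
  where
    split : Has12 (A ++ B) → Has12 A ⊎ Has12 B ⊎ Cross A B
    split AB∋12 with has12⁻ AB∋12
    ... | a , b , p , a<b with ⊆-++⁻ A p
    ... | []         , _      , refl , _  , q  = inj₂ (inj₁ (has12 q a<b))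
    ... | a ∷ []     , b ∷ [] , refl , q₁ , q₂ = inj₂ (inj₂ (a , b , to∈ q₁ , to∈ q₂ , a<b))
    ... | a ∷ b ∷ [] , []     , refl , q  , _  = inj₁ (has12 q a<b)
    join : Has12 A ⊎ Has12 B ⊎ Cross A B → Has12 (A ++ B)
    join (inj₁ A∋12)                            = Contains-resp-⊆ (++⁺ʳ B ⊆-refl) A∋12
    join (inj₂ (inj₁ B∋12))                     = Contains-resp-⊆ (++⁺ˡ A ⊆-refl) B∋12
    join (inj₂ (inj₂ (x , y , x∈A , y∈B , x<y))) = has12 (⊆-++⁺ (from∈ x∈A) (from∈ y∈B)) x<y

Has12-∷ʳ-minimum : ∀ {m} X → All (m <_) X → Has12 (X ++ [ m ]) ⇔ Has12 X
Has12-∷ʳ-minimum {m} X m<X = mk⇔ drop-m (Contains-resp-⊆ (++⁺ʳ [ m ] ⊆-refl))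
  where
    drop-m : Has12 (X ++ [ m ]) → Has12 X
    drop-m Xm∋12 with has12⁻ Xm∋12
    ... | a , b , p , a<b with ⊆-++⁻ X p
    ... | a ∷ b ∷ [] , [] , refl , q , _ = has12 q a<b
    ... | a ∷ [] , b ∷ [] , refl , q , (refl ∷ []) = ⊥-elim (<-asym a<b (All.lookup m<X (to∈ q)))
    ... | [] , _ ∷ _ ∷ [] , refl , _ , (_ ∷ ())
    ... | [] , _ ∷ _ ∷ [] , refl , _ , (_ ∷ʳ ())

Has231-∷ʳ-minimum : ∀ {m} X → All (m <_) X → Has231 (X ++ [ m ]) ⇔ Has12 X
Has231-∷ʳ-minimum {m} X m<X = mk⇔ drop-m add-m
  where
    drop-m : Has231 (X ++ [ m ]) → Has12 X
    drop-m Xm∋231 with has231⁻ Xm∋231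
    ... | b , c , a , p , b<c , _ with ⊆-++⁻ X p
    ... | b ∷ c ∷ a ∷ [] , [] , refl , q , _ = has12 (⊆-trans (refl ∷ refl ∷ (a ∷ʳ [])) q) b<c
    ... | b ∷ c ∷ [] , a ∷ [] , refl , q , _ = has12 q b<c
    ... | b ∷ [] , _ ∷ _ ∷ [] , refl , _ , (_ ∷ ())
    ... | b ∷ [] , _ ∷ _ ∷ [] , refl , _ , (_ ∷ʳ ())
    ... | [] , _ ∷ _ ∷ _ ∷ [] , refl , _ , (_ ∷ ())
    ... | [] , _ ∷ _ ∷ _ ∷ [] , refl , _ , (_ ∷ʳ ())
    add-m : Has12 X → Has231 (X ++ [ m ])
    add-m X∋12 with has12⁻ X∋12
    ... | a , b , p , a<b = has231 (⊆-++⁺ p (⊆-refl {x = [ m ]})) a<b (All.lookup (All-resp-⊆ p m<X) (here refl))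

Has213-around-minimum : ∀ {m} L {R} → All (m <_) (L ++ R) → Has213 (L ++ m ∷ R) ⇔ (Has213 L ⊎ Has213 R ⊎ Cross L R)
Has213-around-minimum {m} L {R} m<LR = mk⇔ split join
  where
    split : Has213 (L ++ m ∷ R) → Has213 L ⊎ Has213 R ⊎ Cross L R
    split (b ∷ a ∷ c ∷ [] , p , so@((e₁ ∷ e₂ ∷ []) ∷ (e₃ ∷ []) ∷ _)) with ⊆-++⁻ L p
    ... | [] , _ , refl , _ , (_ ∷ʳ q) = inj₂ (inj₁ (_ , q , so))
    ... | [] , _ , refl , _ , (refl ∷ q) =
          ⊥-elim (2≮1 (to e₁ (All.lookup (++⁻ʳ L m<LR) (to∈ (⊆-trans (refl ∷ (c ∷ʳ [])) q)))))
    ... | b ∷ [] , _ , refl , q₁ , (_ ∷ʳ q) =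
          inj₂ (inj₂ (b , c , to∈ q₁ , to∈ (⊆-trans (a ∷ʳ ⊆-refl) q) , from e₂ 2<3))
    ... | b ∷ [] , _ , refl , q₁ , (refl ∷ q) = inj₂ (inj₂ (b , c , to∈ q₁ , to∈ q , from e₂ 2<3))
    ... | b ∷ a ∷ [] , _ , refl , q₁ , (_ ∷ʳ q) =
          inj₂ (inj₂ (b , c , to∈ (⊆-trans (refl ∷ (a ∷ʳ [])) q₁) , to∈ q , from e₂ 2<3))
    ... | b ∷ a ∷ [] , _ , refl , q₁ , (refl ∷ q) =
          ⊥-elim (<-asym (from e₃ 1<3) (All.lookup (++⁻ˡ L m<LR) (to∈ (⊆-trans (b ∷ʳ ⊆-refl) q₁))))
    ... | b ∷ a ∷ c ∷ [] , [] , refl , q₁ , _ = inj₁ (_ , q₁ , so)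
    join : Has213 L ⊎ Has213 R ⊎ Cross L R → Has213 (L ++ m ∷ R)
    join (inj₁ L∋213)        = Contains-resp-⊆ (++⁺ʳ _ ⊆-refl) L∋213
    join (inj₂ (inj₁ R∋213)) = Contains-resp-⊆ (++⁺ˡ L (m ∷ʳ ⊆-refl)) R∋213
    join (inj₂ (inj₂ (x , y , x∈L , y∈R , x<y))) =
      has213 (⊆-++⁺ (from∈ x∈L) (refl ∷ from∈ y∈R)) (All.lookup (++⁻ˡ L m<LR) x∈L) x<y

minimum-split : ∀ x l → Unique (x ∷ l) →
                ∃[ L ] ∃[ R ] (x ∷ l ≡ L ++ min x l ∷ R × All (min x l <_) (L ++ R))
minimum-split x l u with ∈-∃++ min∈
  where
    min∈ : min x l ∈ x ∷ l
    min∈ = [ (λ e → subst (_∈ x ∷ l) (sym e) (here refl)) , there ]′ (argmin-sel (λ y → y) x l)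
... | L , R , e = L , R , e , All.tabulate λ y∈LR →
  ≤∧≢⇒< (All.lookup (All-resp-⊆ LR⊆ min≤) y∈LR) (All.lookup (Unique-head (Unique-resp-↭ (shift _ L R) u′)) y∈LR)
  where
    min≤ : All (min x l ≤_) (L ++ min x l ∷ R)
    min≤ = subst (All (min x l ≤_)) e (min≤⊤ x l ∷ min≤xs x l)
    u′ : Unique (L ++ min x l ∷ R)
    u′ = subst Unique e u
    LR⊆ : L ++ R ⊆ L ++ min x l ∷ R
    LR⊆ = ⊆-++⁺ (⊆-refl {x = L}) (_ ∷ʳ ⊆-refl)

SC₁₂-Pattern : List ℕ → Set
SC₁₂-Pattern w = ∀ o → T 𝒜₁₂ w o → (Has213 w ⇔ Has12 o) × (Has213 w ⇔ Has231 o)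

-- SC₁₂ (L m R) = SC₁₂ L · SC₁₂ R · m when m is the minimum, and 213-occurrences of L m R
-- correspond to 12-occurrences of SC₁₂ L · SC₁₂ R.
SC₁₂-Pattern-split : ∀ L m R → All (m <_) (L ++ R) → Unique (L ++ m ∷ R) →
                     SC₁₂-Pattern L → SC₁₂-Pattern R → SC₁₂-Pattern (L ++ m ∷ R)
SC₁₂-Pattern-split L m R m<LR u IH-L IH-R o r =
  subst (λ t → (Has213 (L ++ m ∷ R) ⇔ Has12 t) × (Has213 (L ++ m ∷ R) ⇔ Has231 t)) (sym o≡)
    (⇔.trans 213⇔12X (⇔.sym (Has12-∷ʳ-minimum X m<X)) , ⇔.trans 213⇔12X (⇔.sym (Has231-∷ʳ-minimum X m<X)))
  where
    uL = Unique-resp-⊆ (++⁺ʳ (m ∷ R) (⊆-refl {x = L})) u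
    uR = Unique-resp-⊆ (++⁺ˡ L (m ∷ʳ ⊆-refl)) u
    runL = run ≤-refl L [] (subst Unique (sym (++-identityʳ L)) uL)
    runR = run ≤-refl R [] (subst Unique (sym (++-identityʳ R)) uR)
    oL = proj₁ runL
    oR = proj₁ runR
    X  = oL ++ oR
    oL↭L : oL ↭ L
    oL↭L = subst (oL ↭_) (++-identityʳ L) (Run-↭ (proj₂ runL))
    oR↭R : oR ↭ R
    oR↭R = subst (oR ↭_) (++-identityʳ R) (Run-↭ (proj₂ runR))
    o≡ : o ≡ X ++ [ m ]
    o≡ = trans (Run-deterministic r (Run₁₂-split (proj₂ runL) (proj₂ runR) m<LR
                  (Unique-resp-↭ (∷↭∷ʳ m R) (Unique-resp-⊆ (++⁺ˡ L ⊆-refl) u))))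
               (sym (++-assoc oL oR [ m ]))
    m<X : All (m <_) X
    m<X = All-++⁺ (All-resp-↭ (↭-sym oL↭L) (++⁻ˡ L m<LR)) (All-resp-↭ (↭-sym oR↭R) (++⁻ʳ L m<LR))
    213⇔12X : Has213 (L ++ m ∷ R) ⇔ Has12 X
    213⇔12X = ⇔.trans (Has213-around-minimum L m<LR)
               (⇔.trans (proj₁ (IH-L oL (proj₂ runL)) ⊎-⇔ proj₁ (IH-R oR (proj₂ runR))
                          ⊎-⇔ mk⇔ (Cross-resp-↭ (↭-sym oL↭L) (↭-sym oR↭R)) (Cross-resp-↭ oL↭L oR↭R))
                        (⇔.sym (Has12-++ oL)))

¬Contains-[] : ∀ {x τ} → ¬ Contains [] (x ∷ τ)
¬Contains-[] (_ , [] , ())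

SC₁₂-pattern : ∀ n w → length w ≤ n → Unique w → SC₁₂-Pattern w
SC₁₂-pattern _ [] _ _ .[] stop = ⇔-neither ¬Contains-[] ¬Contains-[] , ⇔-neither ¬Contains-[] ¬Contains-[]
SC₁₂-pattern (suc n) (x ∷ w) (s≤s |w|≤n) u with minimum-split x w u
... | L , R , e , m<LR = subst SC₁₂-Pattern (sym e)
  (SC₁₂-Pattern-split L _ R m<LR u′ (SC₁₂-pattern n L |L|≤n (Unique-resp-⊆ (++⁺ʳ _ ⊆-refl) u′))
                                    (SC₁₂-pattern n R |R|≤n (Unique-resp-⊆ (++⁺ˡ L (_ ∷ʳ ⊆-refl)) u′)))
  where
    u′ = subst Unique e u
    |LR|≡ : suc (length w) ≡ suc (length L + length R)
    |LR|≡ = trans (cong length e) (trans (length-++ L) (+-suc (length L) (length R)))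
    |L|≤n : length L ≤ n
    |L|≤n = ≤-trans (≤-trans (m≤m+n (length L) (length R)) (≤-reflexive (suc-injective (sym |LR|≡)))) |w|≤n
    |R|≤n : length R ≤ n
    |R|≤n = ≤-trans (≤-trans (m≤n+m (length R) (length L)) (≤-reflexive (suc-injective (sym |LR|≡)))) |w|≤n

Sort₁₂≐Av213 : Sort (1 ∷ 2 ∷ []) ≐ Av (2 ∷ 1 ∷ 3 ∷ [])
Sort₁₂≐Av213 π = mk⇔
  (λ (π-perm , o , r , _ , o∌231) → π-perm , λ π∋213 → o∌231 (to (proj₂ (SC₁₂-of π-perm o r)) π∋213))
  (λ (π-perm , π∌213) → let o , r = run ≤-refl π [] (subst Unique (sym (++-identityʳ π)) (IsPerm⇒Unique π-perm)) in
     π-perm , o , r , T-IsPerm r π-perm , λ o∋231 → π∌213 (from (proj₂ (SC₁₂-of π-perm o r)) o∋231))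
  where
    SC₁₂-of : IsPerm π → SC₁₂-Pattern π
    SC₁₂-of π-perm = SC₁₂-pattern _ π ≤-refl (IsPerm⇒Unique π-perm)

-- Counterexamples

Completable : List ℕ → List ℕ → List ℕ → Set
Completable p l τ = ∃[ s ] (s ⊆ l × SameOrder (p ++ s) τ)

Completable? : ∀ p l τ → Dec (Completable p l τ)
Completable? p []      τ = Dec.map′ (λ so → [] , [] , so) (λ { (_ , [] , so) → so }) (SameOrder? (p ++ []) τ)
Completable? p (x ∷ l) τ = Dec.map′ [ skip , take-x ]′ split (Completable? p l τ ⊎-dec Completable? (p ++ [ x ]) l τ)
  where
    skip : Completable p l τ → Completable p (x ∷ l) τ
    skip (s , q , so) = s , x ∷ʳ q , so
    take-x : Completable (p ++ [ x ]) l τ → Completable p (x ∷ l) τ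
    take-x (s , q , so) = x ∷ s , refl ∷ q , subst (λ t → SameOrder t τ) (++-assoc p [ x ] s) so
    split : Completable p (x ∷ l) τ → Completable p l τ ⊎ Completable (p ++ [ x ]) l τ
    split (s , _ ∷ʳ q , so)     = inj₁ (s , q , so)
    split (x ∷ s , refl ∷ q , so) = inj₂ (s , q , subst (λ t → SameOrder t τ) (sym (++-assoc p [ x ] s)) so)

Contains? : ∀ l τ → Dec (Contains l τ)
Contains? = Completable? []

Has231? : ∀ l → Dec (Has231 l)
Has231? l = Contains? l (2 ∷ 3 ∷ 1 ∷ [])

¬IsPermClass-Sort : ∀ {σ π τ oπ oτ} → IsPerm π → T (AvConsec σ) π oπ → ¬ Has231 oπ →
                    IsPerm τ → Contains π τ → T (AvConsec σ) τ oτ → Has231 oτ → ¬ IsPermClass (Sort σ)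
¬IsPermClass-Sort π-perm rπ oπ∌231 τ-perm π∋τ rτ oτ∋231 class
  with class _ _ (π-perm , _ , rπ , T-IsPerm rπ π-perm , oπ∌231) τ-perm π∋τ
... | _ , _ , r , _ , o∌231 = o∌231 (subst Has231 (Run-deterministic rτ r) oτ∋231)

standard⇒IsPerm : ∀ {π} → Unique π → map (rank π) π ≡ π → IsPerm π
standard⇒IsPerm {π} π-u e = subst IsPerm e (proj₁ (proj₂ (standardise π-u)))

-- For concrete π and τ the implicit decisions below are evaluated by the type checker,
-- which runs SC_σ on both inputs.
module Computed (σ : List ℕ) (2≤σ : 2 ≤ length σ) where

  SC-output : ∀ π → Unique π → List ℕ
  SC-output π π-u = proj₁ (run {σ} 2≤σ π [] (subst Unique (sym (++-identityʳ π)) π-u))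

  SC-run : ∀ π π-u → T (AvConsec σ) π (SC-output π π-u)
  SC-run π π-u = proj₂ (run {σ} 2≤σ π [] (subst Unique (sym (++-identityʳ π)) π-u))

  ¬IsPermClass-Sort-example :
    ∀ π τ {π-u : True (unique? π)} {τ-u : True (unique? τ)} → map (rank π) π ≡ π → map (rank τ) τ ≡ τ →
    {_ : False (Has231? (SC-output π (toWitness π-u)))} →
    {_ : True (Has231? (SC-output τ (toWitness τ-u)))} →
    {_ : True (Contains? π τ)} → ¬ IsPermClass (Sort σ)
  ¬IsPermClass-Sort-example π τ {π-u} {τ-u} π-std τ-std {oπ∌231} {oτ∋231} {π∋τ} =
    ¬IsPermClass-Sort (standard⇒IsPerm (toWitness π-u) π-std) (SC-run π _) (toWitnessFalse oπ∌231)
                      (standard⇒IsPerm (toWitness τ-u) τ-std) (toWitness π∋τ) (SC-run τ _) (toWitness oτ∋231)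

Sort₂₁-¬IsPermClass : ¬ IsPermClass (Sort (2 ∷ 1 ∷ []))
Sort₂₁-¬IsPermClass = Computed.¬IsPermClass-Sort-example (2 ∷ 1 ∷ []) ≤-refl
  (3 ∷ 5 ∷ 2 ∷ 4 ∷ 1 ∷ []) (3 ∷ 2 ∷ 4 ∷ 1 ∷ []) refl refl

Sort-length3-¬IsPermClass : ∀ {x y z} → 1 ∈ x ∷ y ∷ z ∷ [] → 2 ∈ x ∷ y ∷ z ∷ [] → 3 ∈ x ∷ y ∷ z ∷ [] →
                            ¬ IsPermClass (Sort (x ∷ y ∷ z ∷ []))
Sort-length3-¬IsPermClass (here refl) (there (here refl)) (there (there (here refl))) =
  Computed.¬IsPermClass-Sort-example _ 2≤3 (3 ∷ 2 ∷ 4 ∷ 1 ∷ 5 ∷ []) (3 ∷ 2 ∷ 1 ∷ 4 ∷ []) refl refl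
Sort-length3-¬IsPermClass (here refl) (there (there (here refl))) (there (here refl)) =
  Computed.¬IsPermClass-Sort-example _ 2≤3 (2 ∷ 4 ∷ 1 ∷ 3 ∷ []) (1 ∷ 3 ∷ 2 ∷ []) refl refl
Sort-length3-¬IsPermClass (there (here refl)) (here refl) (there (there (here refl))) =
  Computed.¬IsPermClass-Sort-example _ 2≤3 (4 ∷ 1 ∷ 3 ∷ 2 ∷ []) (1 ∷ 3 ∷ 2 ∷ []) refl refl
Sort-length3-¬IsPermClass (there (there (here refl))) (here refl) (there (here refl)) =
  Computed.¬IsPermClass-Sort-example _ 2≤3 (2 ∷ 5 ∷ 3 ∷ 1 ∷ 4 ∷ []) (2 ∷ 4 ∷ 1 ∷ 3 ∷ []) refl refl
Sort-length3-¬IsPermClass (there (here refl)) (there (there (here refl))) (here refl) =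
  Computed.¬IsPermClass-Sort-example _ 2≤3 (3 ∷ 1 ∷ 4 ∷ 2 ∷ []) (1 ∷ 3 ∷ 2 ∷ []) refl refl
Sort-length3-¬IsPermClass (there (there (here refl))) (there (here refl)) (here refl) =
  Computed.¬IsPermClass-Sort-example _ 2≤3 (2 ∷ 3 ∷ 1 ∷ 4 ∷ []) (1 ∷ 2 ∷ 3 ∷ []) refl refl
Sort-length3-¬IsPermClass _ _ (there (there (there ())))
Sort-length3-¬IsPermClass _ (there (there (there ()))) _
Sort-length3-¬IsPermClass (there (there (there ()))) _ _

Contains-∷⁻ : ∀ {x l τ} → Contains (x ∷ l) τ → Contains l τ ⊎ ∃[ s ] (s ⊆ l × SameOrder (x ∷ s) τ)
Contains-∷⁻ (s , (_ ∷ʳ p) , so)     = inj₁ (s , p , so)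
Contains-∷⁻ (_ ∷ s , (refl ∷ p) , so) = inj₂ (s , p , so)

Has231-∷-min⁻ : ∀ {x l} → All (x <_) l → Has231 (x ∷ l) → Has231 l
Has231-∷-min⁻ x<l xl∋231 with Contains-∷⁻ xl∋231
... | inj₁ l∋231 = l∋231
... | inj₂ (c ∷ a ∷ [] , p , (_ ∷ e₂ ∷ []) ∷ _) =
  ⊥-elim (2≮1 (to e₂ (All.lookup (All-resp-⊆ p x<l) (there (here refl)))))

Has231-∷-max⁻ : ∀ {x l} → All (_< x) l → Has231 (x ∷ l) → Has231 l
Has231-∷-max⁻ l<x xl∋231 with Contains-∷⁻ xl∋231
... | inj₁ l∋231 = l∋231
... | inj₂ (c ∷ a ∷ [] , p , (e₁ ∷ _ ∷ []) ∷ _) =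
  ⊥-elim (<-asym (from e₁ 2<3) (All.lookup (All-resp-⊆ p l<x) (here refl)))

Has231-second-min⁻ : ∀ {z x l} → All (x <_) (z ∷ l) → Has231 (z ∷ x ∷ l) → Has231 (z ∷ l)
Has231-second-min⁻ {z} (x<z ∷ x<l) zxl∋231 with Contains-∷⁻ zxl∋231
... | inj₁ xl∋231                = Contains-resp-⊆ (z ∷ʳ ⊆-refl) (Has231-∷-min⁻ x<l xl∋231)
... | inj₂ (s , (_ ∷ʳ p) , so)   = _ , refl ∷ p , so
... | inj₂ (c ∷ a ∷ [] , (refl ∷ p) , (e₁ ∷ _ ∷ []) ∷ _) = ⊥-elim (<-asym x<z (from e₁ 2<3))

Has231-∷ʳ-max⁻ : ∀ {x} l → All (_< x) l → Has231 (l ++ [ x ]) → Has231 l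
Has231-∷ʳ-max⁻ {x} l l<x (b ∷ c ∷ a ∷ [] , p , so) with ⊆-++⁻ l p
... | b ∷ c ∷ a ∷ [] , [] , refl , q , _ = _ , q , so
... | b ∷ c ∷ [] , a ∷ [] , refl , q , (refl ∷ []) with so
...   | (_ ∷ e₂ ∷ []) ∷ _ = ⊥-elim (2≮1 (to e₂ (All.lookup (All-resp-⊆ q l<x) (here refl))))
Has231-∷ʳ-max⁻ l _ (b ∷ c ∷ a ∷ [] , p , so) | b ∷ [] , _ ∷ _ ∷ [] , refl , _ , (_ ∷ ())
Has231-∷ʳ-max⁻ l _ (b ∷ c ∷ a ∷ [] , p , so) | b ∷ [] , _ ∷ _ ∷ [] , refl , _ , (_ ∷ʳ ())
Has231-∷ʳ-max⁻ l _ (b ∷ c ∷ a ∷ [] , p , so) | [] , _ ∷ _ ∷ _ ∷ [] , refl , _ , (_ ∷ ())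
Has231-∷ʳ-max⁻ l _ (b ∷ c ∷ a ∷ [] , p , so) | [] , _ ∷ _ ∷ _ ∷ [] , refl , _ , (_ ∷ʳ ())
Has231-∷ʳ-max⁻ l _ (_ ∷ [] , _ , _ ∷ ())
Has231-∷ʳ-max⁻ l _ (_ ∷ _ ∷ [] , _ , _ ∷ _ ∷ ())
Has231-∷ʳ-max⁻ l _ (_ ∷ _ ∷ _ ∷ _ ∷ _ , _ , _ ∷ _ ∷ _ ∷ ())

reverse-∷-∷ : ∀ (a b : ℕ) r → reverse (a ∷ b ∷ r) ≡ reverse r ++ b ∷ a ∷ []
reverse-∷-∷ a b r =
  trans (unfold-reverse a (b ∷ r)) (trans (cong (_++ [ a ]) (unfold-reverse b r)) (++-assoc (reverse r) [ b ] [ a ]))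

-- Counterexamples for σ = σ₁ σ₂ ρ with |σ| ≥ 4; stacks with fewer than |σ| entries never block.
module LongPattern (σ₁ σ₂ : ℕ) (ρ : List ℕ) (σ-perm : IsPerm (σ₁ ∷ σ₂ ∷ ρ)) (2≤|ρ| : 2 ≤ length ρ) where

  σ : List ℕ
  σ = σ₁ ∷ σ₂ ∷ ρ

  𝒜 : PermSet
  𝒜 = AvConsec σ

  k : ℕ
  k = length σ

  σ-u : Unique σ
  σ-u = IsPerm⇒Unique σ-perm

  σ₂ρ-u : Unique (σ₂ ∷ ρ)
  σ₂ρ-u = Unique-resp-⊆ (σ₁ ∷ʳ ⊆-refl) σ-u

  σ₁ρ-u : Unique (σ₁ ∷ ρ)
  σ₁ρ-u = Unique-resp-⊆ (refl ∷ (σ₂ ∷ʳ ⊆-refl)) σ-u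

  ρ-u : Unique ρ
  ρ-u = Unique-resp-⊆ (σ₁ ∷ʳ (σ₂ ∷ʳ ⊆-refl)) σ-u

  |ρ|<k : length ρ < k
  |ρ|<k = ≤-trans (n<1+n _) (n≤1+n _)

  |σ₂ρ|<k : length (σ₂ ∷ ρ) < k
  |σ₂ρ|<k = ≤-refl

  SameOrder⇒ContainsConsec : ∀ {l} → SameOrder l σ → ContainsConsec l σ
  SameOrder⇒ContainsConsec {l} l≅σ = OccursAtStart⇒ContainsConsec
    (subst (λ t → SameOrder t σ) (sym (take-all k l (≤-reflexive (SameOrder-length l≅σ)))) l≅σ)

  σ∋σ : ContainsConsec σ σ
  σ∋σ = SameOrder⇒ContainsConsec (SameOrder-refl σ)

  push′ : ∀ {x xs st out} → Unique (x ∷ st) → ¬ ContainsConsec (x ∷ st) σ →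
          Run 𝒜 xs (x ∷ st) out → Run 𝒜 (x ∷ xs) st out
  push′ u x∷st∌σ = push (canPush u x∷st∌σ)

  pop′ : ∀ {x xs y st out} → ContainsConsec (x ∷ y ∷ st) σ →
         Run 𝒜 (x ∷ xs) st out → Run 𝒜 (x ∷ xs) (y ∷ st) (y ∷ out)
  pop′ x∷y∷st∋σ = pop (cannotPush x∷y∷st∋σ)

  ¬ContainsConsec-∷ : ∀ {x st} → ¬ OccursAtStart (x ∷ st) σ → ¬ ContainsConsec st σ → ¬ ContainsConsec (x ∷ st) σ
  ¬ContainsConsec-∷ ¬start st∌σ c = [ ¬start , st∌σ ]′ (ContainsConsec-∷⁻ c)

  ¬ContainsConsec-short : ∀ {st} → length st < k → ¬ ContainsConsec st σ
  ¬ContainsConsec-short st<k st∋σ = <-irrefl refl (<-≤-trans st<k (ContainsConsec-length st∋σ))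

  pushReversed : ∀ ys {rest out} → Unique ys → length ys < k → Run 𝒜 rest ys out → Run 𝒜 (reverse ys ++ rest) [] out
  pushReversed ys ys-u ys<k = pushAll-reverse ys (λ p → canPush-short (Unique-resp-⊆ p ys-u) (≤-<-trans (length-mono-≤ p) ys<k))

  σ̂-run : T 𝒜 (reverse σ) (σ₂ ∷ σ₁ ∷ ρ)
  σ̂-run = subst (λ t → T 𝒜 t (σ₂ ∷ σ₁ ∷ ρ)) (sym (reverse-∷-∷ σ₁ σ₂ ρ))
    (pushReversed ρ ρ-u |ρ|<k
      (push′ σ₂ρ-u (¬ContainsConsec-short |σ₂ρ|<k)
      (pop′ σ∋σ
      (push′ σ₁ρ-u (¬ContainsConsec-short |σ₂ρ|<k)
      (popAll _)))))

  reverse-σ-perm : IsPerm (reverse σ)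
  reverse-σ-perm = IsPerm-resp-↭ (↭-reverse σ) σ-perm

  run132 : T 𝒜 (1 ∷ 3 ∷ 2 ∷ []) (2 ∷ 3 ∷ 1 ∷ [])
  run132 = pushReversed (2 ∷ 3 ∷ 1 ∷ []) (from-yes (unique? (2 ∷ 3 ∷ 1 ∷ []))) (s≤s (s≤s 2≤|ρ|)) (popAll _)

  perm132 : IsPerm (1 ∷ 3 ∷ 2 ∷ [])
  perm132 = prep 1 (swap 3 2 ↭-refl)

  has231-231 : Has231 (2 ∷ 3 ∷ 1 ∷ [])
  has231-231 = has231 ⊆-refl 2<3 1<2

  -- π = reverse σ outputs σ̂ but contains 132, which outputs 231.
  ¬class-σ̂-avoids231 : Has231 σ → ¬ Has231 (σ₂ ∷ σ₁ ∷ ρ) → ¬ IsPermClass (Sort σ)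
  ¬class-σ̂-avoids231 σ∋231 σ̂∌231 =
    ¬IsPermClass-Sort reverse-σ-perm σ̂-run σ̂∌231 perm132
      (Has132-reverse σ∋231) run132 has231-231
    where
      Has132-reverse : Has231 σ → Has132 (reverse σ)
      Has132-reverse c = Has231-reverse⇒Has132 (Unique-resp-↭ (↭-sym (↭-reverse σ)) σ-u)
                                                 (subst Has231 (sym (reverse-involutive σ)) c)

  σ↭ : σ ↭ range 1 k
  σ↭ = IsPerm⇒↭range σ-perm

  suc-σ↭ : map suc σ ↭ range 2 k
  suc-σ↭ = subst (map suc σ ↭_) (map-suc-range 1 k) (map⁺ suc σ↭)

  σ-positive : All (0 <_) σ
  σ-positive = All.tabulate (λ a∈σ → proj₁ (∈-IsPerm⁻ σ-perm a∈σ))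

  σ≤k : All (_≤ k) σ
  σ≤k = All.tabulate (λ a∈σ → proj₂ (∈-IsPerm⁻ σ-perm a∈σ))

  suc-σ-u : Unique (map suc σ)
  suc-σ-u = Unique-map⁺ suc-injective σ-u

  suc-ρ-u : Unique (map suc ρ)
  suc-ρ-u = Unique-map⁺ suc-injective ρ-u

  |suc-ρ|<k : length (map suc ρ) < k
  |suc-ρ|<k = subst (_< k) (sym (length-map suc ρ)) |ρ|<k

  1+|suc-ρ|<k : suc (length (map suc ρ)) < k
  1+|suc-ρ|<k = s≤s (s≤s (≤-reflexive (length-map suc ρ)))

  SameOrder-suc : ∀ l → SameOrder l (map suc l)
  SameOrder-suc l = SameOrder-map l (λ _ _ → s≤s)

  Has231-suc⁻ : ∀ {l} → Has231 (map suc l) → Has231 l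
  Has231-suc⁻ {l} = Contains-resp-SameOrder (SameOrder-sym (SameOrder-suc l))

  Pointwise-All : ∀ {R : ℕ → ℕ → Set} {P Q : ℕ → Set} {xs ys} → (∀ {a b} → R a b → P a → Q b) →
                  Pointwise R xs ys → All P xs → All Q ys
  Pointwise-All f []       []       = []
  Pointwise-All f (r ∷ rs) (p ∷ ps) = f r p ∷ Pointwise-All f rs ps

  Pointwise-All⁻ : ∀ {R : ℕ → ℕ → Set} {P Q : ℕ → Set} {xs ys} → (∀ {a b} → R a b → Q b → P a) →
                   Pointwise R xs ys → All Q ys → All P xs
  Pointwise-All⁻ f []       []       = []
  Pointwise-All⁻ f (r ∷ rs) (q ∷ qs) = f r q ∷ Pointwise-All⁻ f rs qs

  -- π = (ρ+1)ʳ (σ₂+1) 1 (σ₁+1) is pushed entirely, its output avoids 231, and it contains reverse σ,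
  -- whose output σ̂ contains 231.
  module DescentWithHat231 (σ∌231 : ¬ Has231 σ) (σ₂<σ₁ : σ₂ < σ₁) (σ̂∋231 : Has231 (σ₂ ∷ σ₁ ∷ ρ)) where

    π : List ℕ
    π = reverse (map suc ρ) ++ suc σ₂ ∷ 1 ∷ suc σ₁ ∷ []

    out : List ℕ
    out = suc σ₁ ∷ 1 ∷ map suc (σ₂ ∷ ρ)

    1∷suc-σ-u : Unique (1 ∷ map suc σ)
    1∷suc-σ-u = All-map⁺ (All.map (λ 0<a 1≡1+a → <-irrefl (suc-injective 1≡1+a) 0<a) σ-positive) ∷ suc-σ-u

    1<suc-σ₂ρ : All (1 <_) (map suc (σ₂ ∷ ρ))
    1<suc-σ₂ρ with σ-positive
    ... | _ ∷ 0<σ₂ρ = All-map⁺ (All.map s≤s 0<σ₂ρ)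

    1∷suc-σ₂ρ∌σ : ¬ ContainsConsec (1 ∷ map suc (σ₂ ∷ ρ)) σ
    1∷suc-σ₂ρ∌σ = ¬ContainsConsec-∷ ¬start (¬ContainsConsec-short 1+|suc-ρ|<k)
      where
        ¬start : ¬ OccursAtStart (1 ∷ map suc (σ₂ ∷ ρ)) σ
        ¬start ((e ∷ _) ∷ _) = <-asym σ₂<σ₁ (to e (All.lookup 1<suc-σ₂ρ (here refl)))

    out∌σ : ¬ ContainsConsec out σ
    out∌σ = ¬ContainsConsec-∷ ¬start 1∷suc-σ₂ρ∌σ
      where
        -- 1 below the rest would force σ₂ below all of ρ, and then σ̂ ∋ 231 yields σ ∋ 231.
        ¬start : ¬ OccursAtStart out σ
        ¬start (_ ∷ (second-row ∷ _)) =
          σ∌231 (Contains-resp-⊆ (refl ∷ (σ₂ ∷ʳ ⊆-refl))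
            (Has231-∷-min⁻ (σ₂<σ₁ ∷ Pointwise-All (λ e 1<a → to e 1<a) second-row
                                        (All-resp-⊆ (take-⊆ (length ρ) _) 1<suc-σ₂ρ)) σ̂∋231))

    π-run : T 𝒜 π out
    π-run = pushReversed (map suc ρ) suc-ρ-u |suc-ρ|<k
      (push′ (Unique-resp-⊆ (1 ∷ʳ (suc σ₁ ∷ʳ ⊆-refl)) 1∷suc-σ-u) (¬ContainsConsec-short 1+|suc-ρ|<k)
      (push′ (Unique-resp-⊆ (refl ∷ (suc σ₁ ∷ʳ ⊆-refl)) 1∷suc-σ-u) 1∷suc-σ₂ρ∌σ
      (push′ (Unique-resp-↭ (swap 1 (suc σ₁) ↭-refl) 1∷suc-σ-u) out∌σ
      (popAll _))))

    out∌231 : ¬ Has231 out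
    out∌231 out∋231 =
      σ∌231 (Has231-suc⁻ (Has231-second-min⁻ (s≤s (All.lookup σ-positive (here refl)) ∷ 1<suc-σ₂ρ) out∋231))

    π-perm : IsPerm π
    π-perm = ↭range⇒IsPerm {n = suc k} (begin
      reverse (map suc ρ) ++ suc σ₂ ∷ 1 ∷ suc σ₁ ∷ []   ↭⟨ ++-comm (reverse (map suc ρ)) _ ⟩
      suc σ₂ ∷ 1 ∷ suc σ₁ ∷ reverse (map suc ρ)         ↭⟨ swap (suc σ₂) 1 ↭-refl ⟩
      1 ∷ suc σ₂ ∷ suc σ₁ ∷ reverse (map suc ρ)         ↭⟨ prep 1 (swap (suc σ₂) (suc σ₁) (↭-reverse _)) ⟩
      1 ∷ map suc σ                                      ↭⟨ prep 1 suc-σ↭ ⟩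
      range 1 (suc k)                                    ∎)
      where open PermutationReasoning

    π∋reverse-σ : Contains π (reverse σ)
    π∋reverse-σ =
      reverse (map suc σ) ,
      subst (_⊆ π) (sym (reverse-∷-∷ (suc σ₁) (suc σ₂) (map suc ρ))) (⊆-++⁺ ⊆-refl (refl ∷ 1 ∷ʳ refl ∷ [])) ,
      SameOrder-sym (subst (SameOrder (reverse σ)) (reverse-map suc σ) (SameOrder-suc (reverse σ)))

    ¬class : ¬ IsPermClass (Sort σ)
    ¬class = ¬IsPermClass-Sort π-perm π-run out∌231 reverse-σ-perm π∋reverse-σ σ̂-run σ̂∋231

  -- π = (ρ+1)ʳ σ₂ (σ₁+1) (σ₂+1) contains 132, yet its output σ₂ (σ₂+1) (σ₁+1) (ρ+1) avoids 231.
  module DescentWithMinimum (σ∌231 : ¬ Has231 σ) (σ₂<σ₁ : σ₂ < σ₁) (σ₂<ρ : All (σ₂ <_) ρ) where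

    π : List ℕ
    π = reverse (map suc ρ) ++ σ₂ ∷ suc σ₁ ∷ suc σ₂ ∷ []

    out : List ℕ
    out = σ₂ ∷ suc σ₂ ∷ suc σ₁ ∷ map suc ρ

    σ₂≡1 : σ₂ ≡ 1
    σ₂≡1 = IsPerm-minimum σ-perm (there (here refl)) λ
      { (here refl)               → <⇒≤ σ₂<σ₁
      ; (there (here refl))       → ≤-refl
      ; (there (there b∈ρ))       → <⇒≤ (All.lookup σ₂<ρ b∈ρ) }

    σ₂<suc-ρ : All (σ₂ <_) (map suc ρ)
    σ₂<suc-ρ = All-map⁺ (All.map (λ σ₂<a → <-trans σ₂<a (n<1+n _)) σ₂<ρ)

    σ₂<suc-σ : All (σ₂ <_) (map suc σ)
    σ₂<suc-σ = <-trans σ₂<σ₁ (n<1+n σ₁) ∷ n<1+n σ₂ ∷ σ₂<suc-ρ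

    σ₂∷suc-σ-u : Unique (σ₂ ∷ map suc σ)
    σ₂∷suc-σ-u = All.map (λ σ₂<a σ₂≡a → <-irrefl σ₂≡a σ₂<a) σ₂<suc-σ ∷ suc-σ-u

    blocked : ContainsConsec (suc σ₁ ∷ σ₂ ∷ map suc ρ) σ
    blocked = SameOrder⇒ContainsConsec (SameOrder-sym (subst (SameOrder σ) bumped (SameOrder-map σ (λ _ _ → bumpFrom-strict))))
      where
        bumped : map (bumpFrom (suc σ₂)) σ ≡ suc σ₁ ∷ σ₂ ∷ map suc ρ
        bumped = cong₂ _∷_ (bumpFrom-≥ σ₂<σ₁)
                   (cong₂ _∷_ (bumpFrom-< ≤-refl) (map-cong-∈ ρ (λ a∈ρ → bumpFrom-≥ (All.lookup σ₂<ρ a∈ρ))))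

    suc-σ₂∷σ₁∷ρ∌σ : ¬ ContainsConsec (suc σ₂ ∷ suc σ₁ ∷ map suc ρ) σ
    suc-σ₂∷σ₁∷ρ∌σ = ¬ContainsConsec-∷ ¬start (¬ContainsConsec-short 1+|suc-ρ|<k)
      where
        ¬start : ¬ OccursAtStart (suc σ₂ ∷ suc σ₁ ∷ map suc ρ) σ
        ¬start ((e ∷ _) ∷ _) = <-asym σ₂<σ₁ (to e (s≤s σ₂<σ₁))

    π-run : T 𝒜 π out
    π-run = pushReversed (map suc ρ) suc-ρ-u |suc-ρ|<k
      (push′ (Unique-resp-⊆ (refl ∷ (suc σ₁ ∷ʳ (suc σ₂ ∷ʳ ⊆-refl))) σ₂∷suc-σ-u) (¬ContainsConsec-short 1+|suc-ρ|<k)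
      (pop′ blocked
      (push′ (Unique-resp-⊆ (σ₂ ∷ʳ (refl ∷ (suc σ₂ ∷ʳ ⊆-refl))) σ₂∷suc-σ-u) (¬ContainsConsec-short 1+|suc-ρ|<k)
      (push′ (Unique-resp-↭ (swap (suc σ₁) (suc σ₂) ↭-refl) (Unique-resp-⊆ (σ₂ ∷ʳ ⊆-refl) σ₂∷suc-σ-u)) suc-σ₂∷σ₁∷ρ∌σ
      (popAll _)))))

    out∌231 : ¬ Has231 out
    out∌231 out∋231 =
      σ∌231 (Contains-resp-⊆ (refl ∷ (σ₂ ∷ʳ ⊆-refl)) (Has231-suc⁻
        (Has231-∷-min⁻ (s≤s σ₂<σ₁ ∷ All-map⁺ (All.map s≤s σ₂<ρ))
          (Has231-∷-min⁻ (n<1+n σ₂ ∷ <-trans σ₂<σ₁ (n<1+n σ₁) ∷ σ₂<suc-ρ) out∋231))))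

    π-perm : IsPerm π
    π-perm = ↭range⇒IsPerm {n = suc k} (begin
      reverse (map suc ρ) ++ σ₂ ∷ suc σ₁ ∷ suc σ₂ ∷ []   ↭⟨ ++-comm (reverse (map suc ρ)) _ ⟩
      σ₂ ∷ suc σ₁ ∷ suc σ₂ ∷ reverse (map suc ρ)         ↭⟨ prep σ₂ (prep (suc σ₁) (prep (suc σ₂) (↭-reverse _))) ⟩
      σ₂ ∷ map suc σ                                      ≡⟨ cong (_∷ map suc σ) σ₂≡1 ⟩
      1 ∷ map suc σ                                       ↭⟨ prep 1 suc-σ↭ ⟩
      range 1 (suc k)                                     ∎)
      where open PermutationReasoning

    π∋132 : Has132 π
    π∋132 = has132 (++⁺ˡ (reverse (map suc ρ)) ⊆-refl) (n<1+n σ₂) (s≤s σ₂<σ₁)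

    ¬class : ¬ IsPermClass (Sort σ)
    ¬class = ¬IsPermClass-Sort π-perm π-run out∌231 perm132 π∋132 run132 has231-231

  reverse-σ↭ : reverse σ ↭ range 1 k
  reverse-σ↭ = ↭-trans (↭-reverse σ) σ↭

  -- With K₁ = k+1 and K₂ = k+2, π = ρʳ σ₂ K₁ σ₁ K₂ is pushed entirely and its output avoids 231;
  -- its pattern τ = ρʳ σ₂ σ₁ K₁ outputs σ₂ K₁ σ₁ ρ.
  module AscentWithLargerTail (σ∌231 : ¬ Has231 σ) (σ₁<σ₂ : σ₁ < σ₂) (σ₁<ρ : All (σ₁ <_) ρ)
                              {a} (a∈ρ : a ∈ ρ) (σ₂<a : σ₂ < a) where

    K₁ K₂ : ℕ
    K₁ = suc k
    K₂ = suc K₁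

    σ₁≤k : σ₁ ≤ k
    σ₁≤k = All.lookup σ≤k (here refl)

    σ₂≤k : σ₂ ≤ k
    σ₂≤k = All.lookup σ≤k (there (here refl))

    ρ≤k : All (_≤ k) ρ
    ρ≤k = ++⁻ʳ (σ₁ ∷ σ₂ ∷ []) σ≤k

    τ π : List ℕ
    τ = reverse ρ ++ σ₂ ∷ σ₁ ∷ K₁ ∷ []
    π = reverse ρ ++ σ₂ ∷ K₁ ∷ σ₁ ∷ K₂ ∷ []

    K₂K₁σ-u : Unique (K₂ ∷ K₁ ∷ σ)
    K₂K₁σ-u = ((λ K₂≡K₁ → <-irrefl (sym K₂≡K₁) (n<1+n K₁))
               ∷ All.map (λ a≤k K₂≡a → <-irrefl (sym K₂≡a) (s≤s (m≤n⇒m≤1+n a≤k))) σ≤k)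
            ∷ All.map (λ a≤k K₁≡a → <-irrefl (sym K₁≡a) (s≤s a≤k)) σ≤k ∷ σ-u

    ¬start-K₁ : ∀ {x w} → x ≤ k → ¬ OccursAtStart (K₁ ∷ x ∷ w) σ
    ¬start-K₁ x≤k ((e ∷ _) ∷ _) = <-irrefl refl (<-≤-trans (from e σ₁<σ₂) (m≤n⇒m≤1+n x≤k))

    τ-run : T 𝒜 τ (σ₂ ∷ K₁ ∷ σ₁ ∷ ρ)
    τ-run = pushReversed ρ ρ-u |ρ|<k
      (push′ σ₂ρ-u (¬ContainsConsec-short |σ₂ρ|<k)
      (pop′ σ∋σ
      (push′ σ₁ρ-u (¬ContainsConsec-short |σ₂ρ|<k)
      (push′ (Unique-resp-⊆ (K₂ ∷ʳ (refl ∷ (refl ∷ (σ₂ ∷ʳ ⊆-refl)))) K₂K₁σ-u)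
             (¬ContainsConsec-∷ (¬start-K₁ σ₁≤k) (¬ContainsConsec-short |σ₂ρ|<k))
      (popAll _)))))

    τ-out∋231 : Has231 (σ₂ ∷ K₁ ∷ σ₁ ∷ ρ)
    τ-out∋231 = has231 (refl ∷ refl ∷ refl ∷ minimum ρ) (s≤s σ₂≤k) σ₁<σ₂

    σ₁K₁σ₂ρ∌σ : ¬ ContainsConsec (σ₁ ∷ K₁ ∷ σ₂ ∷ ρ) σ
    σ₁K₁σ₂ρ∌σ = ¬ContainsConsec-∷ ¬start (¬ContainsConsec-∷ (¬start-K₁ σ₂≤k) (¬ContainsConsec-short |σ₂ρ|<k))
      where
        -- K₁ exceeds everything after it, so σ₂ would have to exceed all of ρ, but σ₂ < a ∈ ρ.
        ¬start : ¬ OccursAtStart (σ₁ ∷ K₁ ∷ σ₂ ∷ ρ) σ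
        ¬start (_ ∷ (second-row ∷ _)) =
          All.lookup (Pointwise-All (λ e K₁≮b σ₂<c → K₁≮b (from e σ₂<c)) second-row
                       (All.map (λ b≤k K₁<b → <-irrefl refl (<-≤-trans K₁<b (m≤n⇒m≤1+n b≤k)))
                          (All-resp-⊆ (take-⊆ (length ρ) (σ₂ ∷ ρ)) (σ₂≤k ∷ ρ≤k))))
                     a∈ρ σ₂<a

    π-out∌σ : ¬ ContainsConsec (K₂ ∷ σ₁ ∷ K₁ ∷ σ₂ ∷ ρ) σ
    π-out∌σ = ¬ContainsConsec-∷ ¬start σ₁K₁σ₂ρ∌σ
      where
        ¬start : ¬ OccursAtStart (K₂ ∷ σ₁ ∷ K₁ ∷ σ₂ ∷ ρ) σ
        ¬start ((e ∷ _) ∷ _) = <-irrefl refl (<-≤-trans (from e σ₁<σ₂) (m≤n⇒m≤1+n (m≤n⇒m≤1+n σ₁≤k)))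

    π-run : T 𝒜 π (K₂ ∷ σ₁ ∷ K₁ ∷ σ₂ ∷ ρ)
    π-run = pushReversed ρ ρ-u |ρ|<k
      (push′ σ₂ρ-u (¬ContainsConsec-short |σ₂ρ|<k)
      (push′ (Unique-resp-⊆ (K₂ ∷ʳ (refl ∷ (σ₁ ∷ʳ ⊆-refl))) K₂K₁σ-u)
             (¬ContainsConsec-∷ (¬start-K₁ σ₂≤k) (¬ContainsConsec-short |σ₂ρ|<k))
      (push′ (Unique-resp-↭ (swap K₁ σ₁ ↭-refl) (Unique-resp-⊆ (K₂ ∷ʳ ⊆-refl) K₂K₁σ-u)) σ₁K₁σ₂ρ∌σ
      (push′ (Unique-resp-↭ (prep K₂ (swap K₁ σ₁ ↭-refl)) K₂K₁σ-u) π-out∌σ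
      (popAll _)))))

    π-out∌231 : ¬ Has231 (K₂ ∷ σ₁ ∷ K₁ ∷ σ₂ ∷ ρ)
    π-out∌231 out∋231 = σ∌231 (Contains-resp-⊆ (σ₁ ∷ʳ ⊆-refl)
      (Has231-∷-max⁻ (s≤s σ₂≤k ∷ All.map s≤s ρ≤k)
      (Has231-∷-min⁻ (s≤s σ₁≤k ∷ σ₁<σ₂ ∷ σ₁<ρ)
      (Has231-∷-max⁻ (All.map s≤s (m≤n⇒m≤1+n σ₁≤k ∷ ≤-refl ∷ m≤n⇒m≤1+n σ₂≤k ∷ All.map m≤n⇒m≤1+n ρ≤k)) out∋231))))

    reverse-σ≡ : reverse σ ≡ reverse ρ ++ σ₂ ∷ σ₁ ∷ []
    reverse-σ≡ = reverse-∷-∷ σ₁ σ₂ ρ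

    τ-perm : IsPerm τ
    τ-perm = ↭range⇒IsPerm {n = k + 1} (begin
      reverse ρ ++ σ₂ ∷ σ₁ ∷ K₁ ∷ []        ≡⟨ sym (++-assoc (reverse ρ) (σ₂ ∷ σ₁ ∷ []) [ K₁ ]) ⟩
      (reverse ρ ++ σ₂ ∷ σ₁ ∷ []) ++ [ K₁ ] ≡⟨ cong (_++ [ K₁ ]) (sym reverse-σ≡) ⟩
      reverse σ ++ [ K₁ ]                   ↭⟨ ↭-++⁺ʳ [ K₁ ] reverse-σ↭ ⟩
      range 1 k ++ [ K₁ ]                   ≡⟨ sym (range-++ 1 k 1) ⟩
      range 1 (k + 1)                       ∎)
      where open PermutationReasoning

    π-perm : IsPerm π
    π-perm = ↭range⇒IsPerm {n = k + 2} (begin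
      reverse ρ ++ σ₂ ∷ K₁ ∷ σ₁ ∷ K₂ ∷ []         ↭⟨ ↭-++⁺ˡ (reverse ρ) (prep σ₂ (swap K₁ σ₁ ↭-refl)) ⟩
      reverse ρ ++ σ₂ ∷ σ₁ ∷ K₁ ∷ K₂ ∷ []         ≡⟨ sym (++-assoc (reverse ρ) (σ₂ ∷ σ₁ ∷ []) (K₁ ∷ K₂ ∷ [])) ⟩
      (reverse ρ ++ σ₂ ∷ σ₁ ∷ []) ++ K₁ ∷ K₂ ∷ [] ≡⟨ cong (_++ K₁ ∷ K₂ ∷ []) (sym reverse-σ≡) ⟩
      reverse σ ++ K₁ ∷ K₂ ∷ []                   ↭⟨ ↭-++⁺ʳ (K₁ ∷ K₂ ∷ []) reverse-σ↭ ⟩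
      range 1 k ++ K₁ ∷ K₂ ∷ []                   ≡⟨ sym (range-++ 1 k 2) ⟩
      range 1 (k + 2)                             ∎)
      where open PermutationReasoning

    -- Bumping K₁ to K₂ turns τ into a subsequence of π.
    π∋τ : Contains π τ
    π∋τ = _ , ⊆-++⁺ (⊆-refl {x = reverse ρ}) (refl ∷ (K₁ ∷ʳ (refl ∷ refl ∷ []))) ,
          SameOrder-sym (subst (SameOrder τ) bumped (SameOrder-map τ (λ _ _ → bumpFrom-strict)))
      where
        rρ≤k : All (_≤ k) (reverse ρ)
        rρ≤k = All-resp-↭ (↭-sym (↭-reverse ρ)) ρ≤k
        bumped : map (bumpFrom K₁) τ ≡ reverse ρ ++ σ₂ ∷ σ₁ ∷ K₂ ∷ []
        bumped = trans (map-++ (bumpFrom K₁) (reverse ρ) (σ₂ ∷ σ₁ ∷ K₁ ∷ []))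
          (cong₂ _++_
            (trans (map-cong-∈ (reverse ρ) (λ b∈ → bumpFrom-< (s≤s (All.lookup rρ≤k b∈)))) (map-id (reverse ρ)))
            (cong₂ _∷_ (bumpFrom-< (s≤s σ₂≤k)) (cong₂ _∷_ (bumpFrom-< (s≤s σ₁≤k)) (cong (_∷ []) (bumpFrom-≥ ≤-refl)))))

    ¬class : ¬ IsPermClass (Sort σ)
    ¬class = ¬IsPermClass-Sort π-perm π-run π-out∌231 τ-perm π∋τ τ-run τ-out∋231

  -- σ₂ = k is the maximum.  With K = k+2, π = K ρʳ (σ₂+1) σ₁ σ₂ contains 132,
  -- yet its output (σ₂+1) σ₂ σ₁ ρ K avoids 231.
  module AscentWithMaximum (σ∌231 : ¬ Has231 σ) (σ₁<σ₂ : σ₁ < σ₂)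
                           (σ₁<ρ : All (σ₁ <_) ρ) (ρ<σ₂ : All (_< σ₂) ρ) where

    K : ℕ
    K = suc (suc σ₂)

    π out : List ℕ
    π   = K ∷ reverse ρ ++ suc σ₂ ∷ σ₁ ∷ σ₂ ∷ []
    out = suc σ₂ ∷ σ₂ ∷ σ₁ ∷ ρ ++ [ K ]

    σ₂≡k : σ₂ ≡ k
    σ₂≡k = IsPerm-maximum σ-perm (there (here refl)) λ
      { (here refl)         → <⇒≤ σ₁<σ₂
      ; (there (here refl)) → ≤-refl
      ; (there (there b∈ρ)) → <⇒≤ (All.lookup ρ<σ₂ b∈ρ) }

    σ≤σ₂ : All (_≤ σ₂) σ
    σ≤σ₂ = <⇒≤ σ₁<σ₂ ∷ ≤-refl ∷ All.map <⇒≤ ρ<σ₂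

    out-u : Unique out
    out-u = Unique-resp-↭ (↭-trans (∷↭∷ʳ K (suc σ₂ ∷ σ₁ ∷ σ₂ ∷ ρ)) (prep (suc σ₂) (swap σ₁ σ₂ ↭-refl)))
      (All.map (λ a≤σ₂+1 K≡a → <-irrefl (sym K≡a) (s≤s a≤σ₂+1)) (≤-refl ∷ All.map m≤n⇒m≤1+n σ≤σ₂)
       ∷ All.map (λ a≤σ₂ σ₂+1≡a → <-irrefl (sym σ₂+1≡a) (s≤s a≤σ₂)) σ≤σ₂ ∷ σ-u)

    out<K : All (_< K) (suc σ₂ ∷ σ₂ ∷ σ₁ ∷ ρ)
    out<K = All.map s≤s (≤-refl ∷ n≤1+n σ₂ ∷ m≤n⇒m≤1+n (<⇒≤ σ₁<σ₂) ∷ All.map (m≤n⇒m≤1+n ∘ <⇒≤) ρ<σ₂)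

    ρK⊆out : ρ ++ [ K ] ⊆ out
    ρK⊆out = suc σ₂ ∷ʳ (σ₂ ∷ʳ (σ₁ ∷ʳ ⊆-refl))

    |ρK| : length (ρ ++ [ K ]) ≡ suc (length ρ)
    |ρK| = trans (length-++ ρ) (+-comm (length ρ) 1)

    ρK∌σ : ∀ {x} → ¬ OccursAtStart (x ∷ ρ ++ [ K ]) σ → ¬ ContainsConsec (x ∷ ρ ++ [ K ]) σ
    ρK∌σ ¬start = ¬ContainsConsec-∷ ¬start (¬ContainsConsec-short (≤-reflexive (cong suc |ρK|)))

    -- The last entry of σ₁ ρ K is its maximum, whereas σ₂ exceeds all of ρ.
    σ₁ρK∌σ : ¬ ContainsConsec (σ₁ ∷ ρ ++ [ K ]) σ
    σ₁ρK∌σ = ρK∌σ (¬start ρ ρ<σ₂ (≤-trans (s≤s z≤n) 2≤|ρ|))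
      where
        ¬start : ∀ r → All (_< σ₂) r → 1 ≤ length r →
                 ¬ SameOrder (take (length (σ₁ ∷ σ₂ ∷ r)) (σ₁ ∷ r ++ [ K ])) (σ₁ ∷ σ₂ ∷ r)
        ¬start (r₀ ∷ r′) r<σ₂@(r₀<σ₂ ∷ _) _ (_ ∷ (second-row ∷ _)) =
          All.lookup (Pointwise-All⁻ (λ e σ₂≮b r₀<a → σ₂≮b (to e r₀<a)) second-row′
                                    (All.map (λ b<σ₂ σ₂<b → <-asym b<σ₂ σ₂<b) r<σ₂))
                     (K∈ r′) (<-trans r₀<σ₂ (≤-trans (n<1+n σ₂) (n≤1+n _)))
          where
            second-row′ : Pointwise (λ a b → (r₀ < a) ⇔ (σ₂ < b)) (r′ ++ [ K ]) (r₀ ∷ r′)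
            second-row′ = subst (λ t → Pointwise (λ a b → (r₀ < a) ⇔ (σ₂ < b)) t (r₀ ∷ r′))
              (take-all (suc (length r′)) (r′ ++ [ K ]) (≤-reflexive (trans (length-++ r′) (+-comm (length r′) 1)))) second-row
            K∈ : ∀ (l : List ℕ) → K ∈ l ++ [ K ]
            K∈ []      = here refl
            K∈ (_ ∷ l) = there (K∈ l)

    blocked : ContainsConsec (σ₁ ∷ suc σ₂ ∷ ρ ++ [ K ]) σ
    blocked = OccursAtStart⇒ContainsConsec
      (subst (λ t → SameOrder (σ₁ ∷ suc σ₂ ∷ t) σ) (sym (take-length-++ ρ [ K ]))
        (SameOrder-sym (subst (SameOrder σ) bumped (SameOrder-map σ (λ _ _ → bumpFrom-strict)))))
      where
        bumped : map (bumpFrom σ₂) σ ≡ σ₁ ∷ suc σ₂ ∷ ρ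
        bumped = cong₂ _∷_ (bumpFrom-< σ₁<σ₂)
                   (cong₂ _∷_ (bumpFrom-≥ ≤-refl) (trans (map-cong-∈ ρ (λ a∈ρ → bumpFrom-< (All.lookup ρ<σ₂ a∈ρ))) (map-id ρ)))

    π-run : T 𝒜 π out
    π-run = subst (λ t → T 𝒜 (t ++ suc σ₂ ∷ σ₁ ∷ σ₂ ∷ []) out) (reverse-++ ρ [ K ])
      (pushReversed (ρ ++ [ K ]) (Unique-resp-⊆ ρK⊆out out-u) (≤-reflexive (cong suc |ρK|))
      (push′ (Unique-resp-⊆ (refl ∷ (σ₂ ∷ʳ (σ₁ ∷ʳ ⊆-refl))) out-u) (ρK∌σ ¬start-σ₂+1)
      (pop′ blocked
      (push′ (Unique-resp-⊆ (suc σ₂ ∷ʳ (σ₂ ∷ʳ ⊆-refl)) out-u) σ₁ρK∌σ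
      (push′ (Unique-resp-⊆ (suc σ₂ ∷ʳ ⊆-refl) out-u) (¬ContainsConsec-∷ ¬start-σ₂ σ₁ρK∌σ)
      (popAll _))))))
      where
        ¬start-σ₂+1 : ¬ OccursAtStart (suc σ₂ ∷ ρ ++ [ K ]) σ
        ¬start-σ₂+1 = ¬start ρ ρ<σ₂ (≤-trans (s≤s z≤n) 2≤|ρ|)
          where
            ¬start : ∀ r → All (_< σ₂) r → 1 ≤ length r →
                     ¬ SameOrder (take (length (σ₁ ∷ σ₂ ∷ r)) (suc σ₂ ∷ r ++ [ K ])) (σ₁ ∷ σ₂ ∷ r)
            ¬start (r₀ ∷ _) (r₀<σ₂ ∷ _) _ ((e ∷ _) ∷ _) = <-asym (from e σ₁<σ₂) (m<n⇒m<1+n r₀<σ₂)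
        ¬start-σ₂ : ¬ OccursAtStart (σ₂ ∷ σ₁ ∷ ρ ++ [ K ]) σ
        ¬start-σ₂ ((e ∷ _) ∷ _) = <-asym σ₁<σ₂ (from e σ₁<σ₂)

    out∌231 : ¬ Has231 out
    out∌231 out∋231 = σ∌231 (Contains-resp-⊆ (σ₁ ∷ʳ (σ₂ ∷ʳ ⊆-refl))
      (Has231-∷-min⁻ σ₁<ρ (Has231-∷-max⁻ (σ₁<σ₂ ∷ ρ<σ₂)
        (Has231-∷-max⁻ (n<1+n σ₂ ∷ <-trans σ₁<σ₂ (n<1+n σ₂) ∷ All.map (λ b<σ₂ → <-trans b<σ₂ (n<1+n σ₂)) ρ<σ₂)
          (Has231-∷ʳ-max⁻ (suc σ₂ ∷ σ₂ ∷ σ₁ ∷ ρ) out<K out∋231)))))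

    π-perm : IsPerm π
    π-perm = ↭range⇒IsPerm {n = k + 2} (begin
      K ∷ reverse ρ ++ suc σ₂ ∷ σ₁ ∷ σ₂ ∷ []           ↭⟨ ∷↭∷ʳ K (reverse ρ ++ suc σ₂ ∷ σ₁ ∷ σ₂ ∷ []) ⟩
      (reverse ρ ++ suc σ₂ ∷ σ₁ ∷ σ₂ ∷ []) ++ [ K ]    ↭⟨ ↭-++⁺ʳ [ K ] (++-comm (reverse ρ) _) ⟩
      (suc σ₂ ∷ σ₁ ∷ σ₂ ∷ reverse ρ) ++ [ K ]          ↭⟨ ↭-++⁺ʳ [ K ] middle ⟩
      (σ ++ [ suc σ₂ ]) ++ [ K ]                       ≡⟨ ++-assoc σ [ suc σ₂ ] [ K ] ⟩
      σ ++ suc σ₂ ∷ K ∷ []                             ≡⟨ cong (λ v → σ ++ suc v ∷ suc (suc v) ∷ []) σ₂≡k ⟩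
      σ ++ suc k ∷ suc (suc k) ∷ []                    ↭⟨ ↭-++⁺ʳ _ σ↭ ⟩
      range 1 k ++ suc k ∷ suc (suc k) ∷ []            ≡⟨ sym (range-++ 1 k 2) ⟩
      range 1 (k + 2)                                  ∎)
      where
        open PermutationReasoning
        middle : suc σ₂ ∷ σ₁ ∷ σ₂ ∷ reverse ρ ↭ σ ++ [ suc σ₂ ]
        middle = ↭-trans (↭-sym (shift (suc σ₂) (σ₁ ∷ σ₂ ∷ []) (reverse ρ)))
                   (prep σ₁ (prep σ₂ (↭-trans (prep (suc σ₂) (↭-reverse ρ)) (∷↭∷ʳ (suc σ₂) ρ))))

    π∋132 : Has132 π
    π∋132 with some∈ ρ 2≤|ρ|
      where
        some∈ : ∀ (l : List ℕ) → 2 ≤ length l → ∃[ a ] a ∈ l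
        some∈ (a ∷ _) _ = a , here refl
    ... | a , a∈ρ =
      has132 (K ∷ʳ ⊆-++⁺ (from∈ (∈-resp-↭ (↭-sym (↭-reverse ρ)) a∈ρ)) (refl ∷ (σ₁ ∷ʳ (refl ∷ []))))
                           (All.lookup ρ<σ₂ a∈ρ) (n<1+n σ₂)

    ¬class : ¬ IsPermClass (Sort σ)
    ¬class = ¬IsPermClass-Sort π-perm π-run out∌231 perm132 π∋132 run132 has231-231

  σ₁∉σ₂ρ : All (λ b → ¬ σ₁ ≡ b) (σ₂ ∷ ρ)
  σ₁∉σ₂ρ = Unique-head σ-u

  σ₂∉ρ : All (λ b → ¬ σ₂ ≡ b) ρ
  σ₂∉ρ = Unique-head σ₂ρ-u

  σ₁<ρ : ¬ Has231 σ → σ₁ < σ₂ → All (σ₁ <_) ρ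
  σ₁<ρ σ∌231 σ₁<σ₂ = All.tabulate λ a∈ρ →
    ≢∧≮⇒> (λ a≡σ₁ → All.lookup σ₁∉σ₂ρ (there a∈ρ) (sym a≡σ₁))
          (λ a<σ₁ → σ∌231 (has231 (refl ∷ refl ∷ from∈ a∈ρ) σ₁<σ₂ a<σ₁))

  σ₂<ρ : ¬ Has231 (σ₂ ∷ σ₁ ∷ ρ) → σ₂ < σ₁ → All (σ₂ <_) ρ
  σ₂<ρ σ̂∌231 σ₂<σ₁ = All.tabulate λ a∈ρ →
    ≢∧≮⇒> (λ a≡σ₂ → All.lookup σ₂∉ρ a∈ρ (sym a≡σ₂))
          (λ a<σ₂ → σ̂∌231 (has231 (refl ∷ refl ∷ from∈ a∈ρ) σ₂<σ₁ a<σ₂))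

  ρ<σ₂ : ¬ Any (σ₂ <_) ρ → All (_< σ₂) ρ
  ρ<σ₂ σ₂≮ρ = All.tabulate λ a∈ρ → ≢∧≮⇒> (All.lookup σ₂∉ρ a∈ρ) (All.lookup (¬Any⇒All¬ ρ σ₂≮ρ) a∈ρ)

  ¬class-σ-avoids231 : ¬ Has231 σ → ¬ IsPermClass (Sort σ)
  ¬class-σ-avoids231 σ∌231 with <-cmp σ₁ σ₂
  ... | tri≈ _ σ₁≡σ₂ _ = ⊥-elim (All.lookup σ₁∉σ₂ρ (here refl) σ₁≡σ₂)
  ... | tri< σ₁<σ₂ _ _ with any? (σ₂ <?_) ρ
  ...   | yes σ₂<some = let _ , a∈ρ , σ₂<a = find σ₂<some in
                        AscentWithLargerTail.¬class σ∌231 σ₁<σ₂ (σ₁<ρ σ∌231 σ₁<σ₂) a∈ρ σ₂<a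
  ...   | no  σ₂≮ρ    = AscentWithMaximum.¬class σ∌231 σ₁<σ₂ (σ₁<ρ σ∌231 σ₁<σ₂) (ρ<σ₂ σ₂≮ρ)
  ¬class-σ-avoids231 σ∌231 | tri> _ _ σ₂<σ₁ with Has231? (σ₂ ∷ σ₁ ∷ ρ)
  ... | yes σ̂∋231 = DescentWithHat231.¬class σ∌231 σ₂<σ₁ σ̂∋231
  ... | no  σ̂∌231 = DescentWithMinimum.¬class σ∌231 σ₂<σ₁ (σ₂<ρ σ̂∌231 σ₂<σ₁)

  ¬class-unless-both231 : ¬ (Has231 σ × Has231 (σ₂ ∷ σ₁ ∷ ρ)) → ¬ IsPermClass (Sort σ)
  ¬class-unless-both231 ¬both with Has231? σ
  ... | yes σ∋231 = ¬class-σ̂-avoids231 σ∋231 (λ σ̂∋231 → ¬both (σ∋231 , σ̂∋231))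
  ... | no  σ∌231 = ¬class-σ-avoids231 σ∌231

¬IsPermClass-Sort-unless-both231 : ∀ σ₁ σ₂ ρ → IsPerm (σ₁ ∷ σ₂ ∷ ρ) → 1 ≤ length ρ →
                                   ¬ (Has231 (σ₁ ∷ σ₂ ∷ ρ) × Has231 (σ₂ ∷ σ₁ ∷ ρ)) →
                                   ¬ IsPermClass (Sort (σ₁ ∷ σ₂ ∷ ρ))
¬IsPermClass-Sort-unless-both231 σ₁ σ₂ (c ∷ []) σ-perm _ _ =
  Sort-length3-¬IsPermClass (∈-IsPerm⁺ σ-perm ≤-refl (s≤s z≤n)) (∈-IsPerm⁺ σ-perm (s≤s z≤n) 2≤3)
                            (∈-IsPerm⁺ σ-perm (s≤s z≤n) ≤-refl)
¬IsPermClass-Sort-unless-both231 σ₁ σ₂ ρ@(_ ∷ _ ∷ _) σ-perm _ ¬both =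
  LongPattern.¬class-unless-both231 σ₁ σ₂ ρ σ-perm (s≤s (s≤s z≤n)) ¬both

Sort≐Av132 : ∀ σ₁ σ₂ ρ → IsPerm (σ₁ ∷ σ₂ ∷ ρ) → Has231 (σ₁ ∷ σ₂ ∷ ρ) → Has231 (σ₂ ∷ σ₁ ∷ ρ) →
             Sort (σ₁ ∷ σ₂ ∷ ρ) ≐ Av (1 ∷ 3 ∷ 2 ∷ [])
Sort≐Av132 σ₁ σ₂ ρ σ-perm σ∋231 σ̂∋231 π =
  mk⇔ (BothContain231.Sort⇒Av132 σ₁ σ₂ ρ σ₁≢σ₂ σ∋231 σ̂∋231 π) (Av132⇒Sort (σ₁ ∷ σ₂ ∷ ρ) σ∋231 π)
  where
    σ₁≢σ₂ : ¬ σ₁ ≡ σ₂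
    σ₁≢σ₂ = All.lookup (Unique-head (IsPerm⇒Unique σ-perm)) (here refl)

theorem2p2 : (Sort (1 ∷ 2 ∷ []) ≐ Av (2 ∷ 1 ∷ 3 ∷ []))
           × (¬ IsPermClass (Sort (2 ∷ 1 ∷ [])))
           × (∀ (σ : List ℕ) → IsPerm σ → 3 ≤ length σ →
                (IsPermClass (Sort σ) ⇔ (Contains σ (2 ∷ 3 ∷ 1 ∷ []) × Contains (hat σ) (2 ∷ 3 ∷ 1 ∷ [])))
                × (IsPermClass (Sort σ) → Sort σ ≐ Av (1 ∷ 3 ∷ 2 ∷ [])))
theorem2p2 = Sort₁₂≐Av213 , Sort₂₁-¬IsPermClass , length≥3
  where
    length≥3 : ∀ (σ : List ℕ) → IsPerm σ → 3 ≤ length σ →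
               (IsPermClass (Sort σ) ⇔ (Has231 σ × Has231 (hat σ)))
               × (IsPermClass (Sort σ) → Sort σ ≐ Av (1 ∷ 3 ∷ 2 ∷ []))
    length≥3 (σ₁ ∷ σ₂ ∷ ρ) σ-perm (s≤s (s≤s 1≤|ρ|)) with Has231? (σ₁ ∷ σ₂ ∷ ρ) ×-dec Has231? (σ₂ ∷ σ₁ ∷ ρ)
    ... | yes (σ∋231 , σ̂∋231) =
          ⇔-both (IsPermClass-resp-≐ Sort≐Av (Av-isPermClass _)) (σ∋231 , σ̂∋231) , λ _ → Sort≐Av
      where Sort≐Av = Sort≐Av132 σ₁ σ₂ ρ σ-perm σ∋231 σ̂∋231
    ... | no ¬both = ⇔-neither ¬class ¬both , λ class → ⊥-elim (¬class class)
      where ¬class = ¬IsPermClass-Sort-unless-both231 σ₁ σ₂ ρ σ-perm 1≤|ρ| ¬both
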